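{- Let $n\ge 3$ and consider the wheel graph $W_{n+1}$. For vertices $x,y$ let $F_{W_{n+1}}(x\mid y)$ denote the number of two-component spanning forests of $W_{n+1}$ in which $x$ and $y$ lie in different components. Then \begin{itemize} \item $F_{W_{n+1}}(v_1\mid v_2)=2(f_{2n-1}-1)$; \item $F_{W_{n+1}}(v_1\mid v_3)=2(\ell_{2n-2}-3)$; \item $F_{W_{n+1}}(v_1\mid v_c)=f_{2n}$. \end{itemize}
   Context: The wheel graph $W_{n+1}$ has a central vertex $v_c$ and cycle vertices $v_1,\dots,v_n$; its edges are the spokes $\{v_c,v_i\}$ ($1\le i\le n$) and the cycle edges $\{v_i,v_{i+1}\}$ ($1\le i\le n-1$) and $\{v_n,v_1\}$. A two-component spanning forest is an acyclic spanning subgraph with exactly two connected components. $f_i$ are the Fibonacci numbers ($f_0=0$, $f_1=1$, $f_{i+2}=f_{i+1}+f_i$) and $\ell_j$ the Lucas numbers ($\ell_0=2$, $\ell_1=1$, $\ell_{j+2}=\ell_{j+1}+\ell_j$). -}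

module Defs where

open import Data.Nat using (ℕ; zero; suc; _+_; _≤_; NonZero)
open import Data.Nat.DivMod using (_mod_)
open import Data.Fin using (Fin; zero; suc; toℕ; splitAt)
open import Data.Fin.Subset using (Subset; _∈_)
open import Data.Product using (Σ; ∃; _×_; _,_)
open import Data.Sum using (_⊎_; inj₁; inj₂; [_,_])
open import Data.List using (List; length)
open import Data.List.Relation.Unary.Unique.Propositional using (Unique)
import Data.List.Membership.Propositional as LM
open import Relation.Nullary using (¬_)
open import Relation.Binary.PropositionalEquality using (_≡_)
open import Relation.Binary.Construct.Closure.ReflexiveTransitive using (Star)
open import Function using (Injective; _∘_)
open import Function.Bundles using (_⇔_)

fib : ℕ → ℕ
fib zero = 0
fib (suc zero) = 1
fib (suc (suc n)) = fib (suc n) + fib n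

lucas : ℕ → ℕ
lucas zero = 2
lucas (suc zero) = 1
lucas (suc (suc n)) = lucas (suc n) + lucas n

-- Vertices of the wheel W_{n+1}: zero is the centre v_c, suc i is v_{i+1}.
Vertex : ℕ → Set
Vertex n = Fin (suc n)

centre : ∀ {n} → Vertex n
centre = zero

cyc : ∀ {n} → Fin n → Vertex n
cyc i = suc i

next : ∀ {n} .{{_ : NonZero n}} → Fin n → Fin n
next {n} i = suc (toℕ i) mod n

-- Edges of W_{n+1}: indices Fin (n + n); the first n are the spokes
-- {v_c, v_{i+1}}, the last n are the cycle edges {v_{i+1}, v_{i+2 mod n}}.
Edge : ℕ → Set
Edge n = Fin (n + n)

ends : ∀ {n} .{{_ : NonZero n}} → Edge n → Vertex n × Vertex n
ends {n} e = [ (λ i → centre , cyc i) , (λ i → cyc i , cyc (next i)) ] (splitAt n e)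

Joins : ∀ {n} .{{_ : NonZero n}} → Edge n → Vertex n → Vertex n → Set
Joins e u w with ends e
... | (a , b) = (a ≡ u × b ≡ w) ⊎ (a ≡ w × b ≡ u)

-- A spanning subgraph of W_{n+1} is given by its edge set S.
Adjacent : ∀ {n} .{{_ : NonZero n}} → Subset (n + n) → Vertex n → Vertex n → Set
Adjacent {n} S u w = Σ (Edge n) λ e → e ∈ S × Joins e u w

Connected : ∀ {n} .{{_ : NonZero n}} → Subset (n + n) → Vertex n → Vertex n → Set
Connected S = Star (Adjacent S)

HasCycle : ∀ {n} .{{_ : NonZero n}} → Subset (n + n) → Set
HasCycle {n} S =
  Σ ℕ λ k → Σ (3 ≤ suc k) λ _ → Σ (Fin (suc k) → Vertex n) λ u →
    Injective _≡_ _≡_ u × (∀ i → Adjacent S (u i) (u (next i)))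

Acyclic : ∀ {n} .{{_ : NonZero n}} → Subset (n + n) → Set
Acyclic S = ¬ HasCycle S

TwoComponents : ∀ {n} .{{_ : NonZero n}} → Subset (n + n) → Set
TwoComponents {n} S =
  Σ (Vertex n) λ a → Σ (Vertex n) λ b →
    ¬ Connected S a b × (∀ w → Connected S a w ⊎ Connected S b w)

SepForest : ∀ {n} .{{_ : NonZero n}} → Vertex n → Vertex n → Subset (n + n) → Set
SepForest x y S = Acyclic S × TwoComponents S × ¬ Connected S x y

HasCount : ∀ {m} → (Subset m → Set) → ℕ → Set
HasCount {m} P k =
  Σ (List (Subset m)) λ L → Unique L × (∀ S → (S LM.∈ L) ⇔ P S) × length L ≡ k

ForestCount : ∀ {n} .{{_ : NonZero n}} → Vertex n → Vertex n → ℕ → Set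
ForestCount x y k = HasCount (SepForest x y) k

{-# OPTIONS --safe #-}
-- Scan the wheel one rim vertex at a time: step i adds spoke i and then rim edge i.  Whether
-- the edges seen so far can still be completed to a two-component forest separating x = v₁
-- from y depends only on how four tracked vertices (the centre, x, y and the rim vertex
-- reached last) are partitioned into components: closing a cycle, connecting x to y, or
-- leaving behind a component that contains none of them (a third component) rules the edge
-- set out.  This is a finite automaton on partitions of four slots, proved correct by an
-- invariant relating its state to a component labelling of the edges seen.  Counting the
-- accepted edge sets gives a transfer recurrence: from each reachable partition the number
-- of completions over u further rim vertices is F(2u+1), F(2u+2), F(2u+3) or L(2u+2) − 2,
-- and summing over the first two steps gives the three formulas.
module Submission where

open import Level using (0ℓ)
open import Data.Nat using (ℕ; zero; suc; _+_; _*_; _∸_; _≤_; _<_; z≤n; s≤s; NonZero)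
open import Data.Nat.Properties
open import Data.Nat.DivMod using (_mod_; m<n⇒m%n≡m; n%n≡0; m%n<n)
open import Data.Nat.ListAction using (sum)
open import Data.Nat.Tactic.RingSolver using (solve; solve-∀)
open import Data.Fin as Fin using (Fin; zero; suc; toℕ; _↑ˡ_; _↑ʳ_; splitAt)
open import Data.Fin.Properties
  using (toℕ-injective; toℕ<n; toℕ-fromℕ<; splitAt-↑ˡ; splitAt-↑ʳ; splitAt⁻¹-↑ˡ; splitAt⁻¹-↑ʳ)
  renaming (suc-injective to cyc-injective)
open import Data.Fin.Subset using (Subset) renaming (_∈_ to _∈ₛ_)
open import Data.Bool using (Bool; true; false)
open import Data.Unit using (⊤; tt)
open import Data.Empty using (⊥; ⊥-elim)
open import Data.Product using (Σ; ∃; _×_; _,_; proj₁; proj₂)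
open import Data.Sum using (_⊎_; inj₁; inj₂; [_,_]′; swap)
open import Data.List using (List; []; _∷_; [_]; length; map; _++_)
import Data.List as List
open import Data.List.Properties using (length-map; length-++; map-cong)
open import Data.List.Relation.Unary.All using (All; []; _∷_)
open import Data.List.Relation.Unary.All.Properties using (¬Any⇒All¬; All¬⇒¬Any)
open import Data.List.Relation.Unary.AllPairs using ([]; _∷_)
open import Data.List.Relation.Unary.Any using (here; there; any?)
open import Data.List.Relation.Unary.Unique.Propositional using (Unique)
import Data.List.Relation.Unary.Unique.Propositional.Properties as Unique
open import Data.List.Membership.Propositional using (_∈_)
open import Data.List.Membership.Propositional.Properties using (∈-map⁺; ∈-map⁻; ∈-++⁺ˡ; ∈-++⁺ʳ; ∈-++⁻)
open import Data.Vec using (Vec; []; _∷_; lookup) renaming (_++_ to _++ᵥ_)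
import Data.Vec as Vec
open import Data.Vec.Properties using ([]=⇒lookup; lookup⇒[]=; lookup-++ˡ; lookup-++ʳ; ++-injective)
open import Function using (Injective; _∘_; _on_)
open import Function.Bundles using (_⇔_; mk⇔; Equivalence)
import Function.Properties.Equivalence as ⇔
open import Relation.Binary.Core using (Rel; _⇒_; _=[_]⇒_)
open import Relation.Binary.Definitions using (DecidableEquality)
open import Relation.Binary.Construct.Union using (_∪_)
open import Relation.Binary.Construct.Closure.ReflexiveTransitive using (Star; ε; _◅_; _◅◅_; fold)
import Relation.Binary.Construct.Closure.ReflexiveTransitive as Star
open import Relation.Binary.PropositionalEquality
  using (_≡_; _≢_; refl; sym; trans; cong; cong₂; subst; subst₂; _≗_; ≢-sym; module ≡-Reasoning)
open import Relation.Nullary using (¬_; Dec; yes; no; ¬?)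
open import Relation.Nullary.Decidable using (_×-dec_; _⊎-dec_; map′)
open import Defs

toℕ-mod : ∀ {K t} .{{_ : NonZero K}} → t < K → toℕ (t mod K) ≡ t
toℕ-mod {K} {t} t<K = trans (toℕ-fromℕ< (m%n<n t K)) (m<n⇒m%n≡m t<K)

toℕ-mod-self : ∀ K .{{_ : NonZero K}} → toℕ (K mod K) ≡ 0
toℕ-mod-self K = trans (toℕ-fromℕ< (m%n<n K K)) (n%n≡0 K)

all⊎any< : ∀ {A B : ℕ → Set} N → (∀ {t} → t < N → A t ⊎ B t) →
           (∀ {t} → t < N → A t) ⊎ Σ ℕ λ t → t < N × B t
all⊎any< zero h = inj₁ λ ()
all⊎any< {A} {B} (suc N) h with all⊎any< {A} {B} N (h ∘ m<n⇒m<1+n) | h (n<1+n N)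
... | inj₂ (t , t<N , b) | _     = inj₂ (t , m<n⇒m<1+n t<N , b)
... | inj₁ _             | inj₂ b = inj₂ (N , n<1+n N , b)
... | inj₁ all           | inj₁ a = inj₁ all′
  where
  all′ : ∀ {t} → t < suc N → A t
  all′ t<1+N with m<1+n⇒m<n∨m≡n t<1+N
  ... | inj₁ t<N  = all t<N
  ... | inj₂ refl = a

constant-on : ∀ (H : ℕ → ℕ) {a b} → a ≤ b → (∀ {t} → a ≤ t → t < b → H t ≡ H (suc t)) →
              H a ≡ H b
constant-on H {b = zero} z≤n _ = refl
constant-on H {a} {suc b} a≤1+b step with m≤n⇒m<n∨m≡n a≤1+b
... | inj₂ refl      = refl
... | inj₁ (s≤s a≤b) = trans (constant-on H a≤b (λ p q → step p (m<n⇒m<1+n q))) (step a≤b (n<1+n b))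

-- Cycles of a relation

module _ {V : Set} where

  -- HasCycle S is Cyclic (Adjacent S).
  Cyclic : Rel V 0ℓ → Set
  Cyclic R = Σ ℕ λ k → Σ (3 ≤ suc k) λ _ → Σ (Fin (suc k) → V) λ u →
    Injective _≡_ _≡_ u × (∀ i → R (u i) (u (next i)))

  Cyclic-map : ∀ {R R′ : Rel V 0ℓ} → R ⇒ R′ → Cyclic R → Cyclic R′
  Cyclic-map f (k , 3≤ , u , inj , step) = k , 3≤ , u , inj , f ∘ step

  record Cycleℕ (R : Rel V 0ℓ) : Set where
    field
      len          : ℕ
      3≤len        : 3 ≤ len
      at           : ℕ → V
      at-injective : ∀ {s t} → s < len → t < len → at s ≡ at t → s ≡ t
      at-step      : ∀ {t} → t < len → R (at t) (at (suc t))
      at-closed    : at len ≡ at 0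

  cyclic⇒cycleℕ : ∀ {R} → Cyclic R → Cycleℕ R
  cyclic⇒cycleℕ {R} (k , 3≤ , u , inj , step) = record
    { len          = K
    ; 3≤len        = 3≤
    ; at           = at
    ; at-injective = λ p q e → trans (sym (toℕ-mod p)) (trans (cong toℕ (inj e)) (toℕ-mod q))
    ; at-step      = λ {t} p → subst (λ s → R (at t) (u (suc s mod K))) (toℕ-mod p) (step (t mod K))
    ; at-closed    = cong u (toℕ-injective (trans (toℕ-mod-self K) (sym (toℕ-mod {K} {0} (s≤s z≤n)))))
    }
    where
    K = suc k
    at : ℕ → V
    at t = u (t mod K)

  cycleℕ⇒cyclic : ∀ {R} → Cycleℕ R → Cyclic R
  cycleℕ⇒cyclic {R} record { len = suc k ; 3≤len = 3≤ ; at = at ; at-injective = inj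
                            ; at-step = step ; at-closed = closed } =
    k , 3≤ , at ∘ toℕ , (λ e → toℕ-injective (inj (toℕ<n _) (toℕ<n _) e)) , step′
    where
    step′ : ∀ i → R (at (toℕ i)) (at (toℕ (next i)))
    step′ i with suc (toℕ i) <? suc k
    ... | yes p = subst (λ s → R (at (toℕ i)) (at s)) (sym (toℕ-mod p)) (step (toℕ<n i))
    ... | no ¬p = subst (R (at (toℕ i))) (begin
        at (suc (toℕ i))         ≡⟨ cong at last ⟩
        at (suc k)               ≡⟨ closed ⟩
        at 0                     ≡⟨ cong at (sym (trans (cong (λ s → toℕ (s mod suc k)) last)
                                                       (toℕ-mod-self (suc k)))) ⟩
        at (toℕ (next i))        ∎) (step (toℕ<n i))
      where
      open ≡-Reasoning
      last : suc (toℕ i) ≡ suc k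
      last = ≤-antisym (toℕ<n i) (≮⇒≥ ¬p)

  Link : V → V → Rel V 0ℓ
  Link u w a b = (u ≡ a × w ≡ b) ⊎ (u ≡ b × w ≡ a)

  module CycleLinks {R : Rel V 0ℓ} (C : Cycleℕ R) where
    open Cycleℕ C

    len≢2 : len ≢ 2
    len≢2 e = <-irrefl refl (subst (3 ≤_) e 3≤len)

    no-reversal : ∀ {i t} → i < len → t < len → at t ≡ at (suc i) → at (suc t) ≡ at i → ⊥
    no-reversal {i} {t} i<len t<len e₁ e₂ with suc i <? len
    ... | no ¬1+i<len = len≢2 (trans (sym 1+i≡len) (cong suc (sym 1≡i)))
      where
      1+i≡len = ≤-antisym i<len (≮⇒≥ ¬1+i<len)
      t≡0 : t ≡ 0
      t≡0 = at-injective t<len (≤-trans (s≤s z≤n) 3≤len) (trans e₁ (trans (cong at 1+i≡len) at-closed))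
      1≡i : 1 ≡ i
      1≡i = at-injective (≤-trans (s≤s (s≤s z≤n)) 3≤len) i<len (subst (λ s → at (suc s) ≡ at i) t≡0 e₂)
    ... | yes 1+i<len with at-injective t<len 1+i<len e₁
    ...   | refl with suc (suc i) <? len
    ...     | yes 2+i<len = <-irrefl (sym (at-injective 2+i<len i<len e₂)) (m<n⇒m<1+n (n<1+n i))
    ...     | no ¬2+i<len = len≢2 (trans (sym 2+i≡len) (cong (λ s → suc (suc s)) (sym 0≡i)))
      where
      2+i≡len = ≤-antisym 1+i<len (≮⇒≥ ¬2+i<len)
      0≡i : 0 ≡ i
      0≡i = at-injective (≤-trans (s≤s z≤n) 3≤len) i<len
                         (trans (sym at-closed) (trans (cong at (sym 2+i≡len)) e₂))

    link-unique : ∀ {u w i t} → i < len → t < len →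
                  Link u w (at i) (at (suc i)) → Link u w (at t) (at (suc t)) → i ≡ t
    link-unique i<len t<len (inj₁ (a₁ , b₁)) (inj₁ (a₂ , b₂)) = at-injective i<len t<len (trans (sym a₁) a₂)
    link-unique i<len t<len (inj₂ (a₁ , b₁)) (inj₂ (a₂ , b₂)) = at-injective i<len t<len (trans (sym b₁) b₂)
    link-unique i<len t<len (inj₁ (a₁ , b₁)) (inj₂ (a₂ , b₂)) =
      ⊥-elim (no-reversal i<len t<len (trans (sym b₂) b₁) (trans (sym a₂) a₁))
    link-unique i<len t<len (inj₂ (a₁ , b₁)) (inj₁ (a₂ , b₂)) =
      ⊥-elim (no-reversal i<len t<len (trans (sym a₂) a₁) (trans (sym b₂) b₁))

-- Component labellings and adding a link

module _ {V : Set} where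

  record AddsLink (R R′ : Rel V 0ℓ) (u w : V) : Set where
    field
      keep  : R ⇒ R′
      link  : Link u w ⇒ R′
      split : R′ ⇒ R ∪ Link u w

  Star-constant : ∀ {R : Rel V 0ℓ} {lab : V → ℕ} → R =[ lab ]⇒ _≡_ → Star R =[ lab ]⇒ _≡_
  Star-constant {lab = lab} resp = fold (_≡_ on lab) (trans ∘ resp) refl

  module _ {R R′ : Rel V 0ℓ} {u w : V} (X : AddsLink R R′ u w) {lab : V → ℕ} (resp : R =[ lab ]⇒ _≡_) where
    open AddsLink X

    AddsLink-acyclic : lab u ≢ lab w → ¬ Cyclic R → ¬ Cyclic R′
    AddsLink-acyclic u≁w acyclic c = refute (all⊎any< len (split ∘ at-step))
      where
      C : Cycleℕ R′
      C = cyclic⇒cycleℕ c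
      open Cycleℕ C
      open CycleLinks C
      refute : (∀ {t} → t < len → R (at t) (at (suc t))) ⊎
               Σ ℕ (λ t → t < len × Link u w (at t) (at (suc t))) → ⊥
      refute (inj₁ old) = acyclic (cycleℕ⇒cyclic {R = R} record
        { len = len ; 3≤len = 3≤len ; at = at ; at-injective = at-injective ; at-step = old ; at-closed = at-closed })
      refute (inj₂ (i , i<len , linkᵢ)) = u≁w (ends-linked linkᵢ)
        where
        H = lab ∘ at
        old : ∀ {t} → t < len → t ≢ i → H t ≡ H (suc t)
        old {t} t<len t≢i with split (at-step t<len)
        ... | inj₁ r = resp r
        ... | inj₂ l = ⊥-elim (t≢i (link-unique t<len i<len l linkᵢ))
        around : H (suc i) ≡ H i
        around = begin
          H (suc i) ≡⟨ constant-on H i<len (λ i<t t<len → old t<len (≢-sym (<⇒≢ i<t))) ⟩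
          H len     ≡⟨ cong lab at-closed ⟩
          H 0       ≡⟨ constant-on H z≤n (λ _ t<i → old (<-trans t<i i<len) (<⇒≢ t<i)) ⟩
          H i       ∎
          where open ≡-Reasoning
        ends-linked : Link u w (at i) (at (suc i)) → lab u ≡ lab w
        ends-linked (inj₁ (refl , refl)) = sym around
        ends-linked (inj₂ (refl , refl)) = around

replace : ℕ → ℕ → ℕ → ℕ
replace old new v with v ≟ old
... | yes _ = new
... | no _  = v

relabel : {A : Set} → (A → ℕ) → A → A → A → ℕ
relabel lab u w z = replace (lab w) (lab u) (lab z)

module _ {A : Set} (lab : A → ℕ) (u w : A) where

  relabel-source : relabel lab u w u ≡ lab u
  relabel-source with lab u ≟ lab w
  ... | yes _ = refl
  ... | no _  = refl

  relabel-joined : ∀ {z} → lab z ≡ lab w → relabel lab u w z ≡ lab u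
  relabel-joined {z} z~w with lab z ≟ lab w
  ... | yes _   = refl
  ... | no z≁w  = ⊥-elim (z≁w z~w)

  relabel-other : ∀ {z} → lab z ≢ lab w → relabel lab u w z ≡ lab z
  relabel-other {z} z≁w with lab z ≟ lab w
  ... | yes z~w = ⊥-elim (z≁w z~w)
  ... | no _    = refl

  relabel-≢ : ∀ {a z} → lab a ≢ lab u → lab a ≢ lab w → lab a ≢ lab z →
              relabel lab u w a ≢ relabel lab u w z
  relabel-≢ {a} {z} a≁u a≁w a≁z rewrite relabel-other a≁w with lab z ≟ lab w
  ... | yes _ = a≁u
  ... | no _  = a≁z

  relabel-isolated : ∀ {t} → (∀ {z} → lab z ≡ lab t → z ≡ t) → u ≢ t → w ≢ t →
                     ∀ {z} → relabel lab u w z ≡ relabel lab u w t → z ≡ t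
  relabel-isolated {t} isolated u≢t w≢t {z} e with lab t ≟ lab w
  ... | yes t~w = ⊥-elim (w≢t (isolated (sym t~w)))
  ... | no _ with lab z ≟ lab w
  ...   | yes _ = ⊥-elim (u≢t (isolated e))
  ...   | no _  = isolated e

module _ {V : Set} {R R′ : Rel V 0ℓ} {u w : V} (X : AddsLink R R′ u w) {lab : V → ℕ} where
  open AddsLink X

  relabel-respects : R =[ lab ]⇒ _≡_ → R′ =[ relabel lab u w ]⇒ _≡_
  relabel-respects resp r with split r
  ... | inj₁ r₀                   = cong (replace (lab w) (lab u)) (resp r₀)
  ... | inj₂ (inj₁ (refl , refl)) = trans (relabel-source lab u w) (sym (relabel-joined lab u w refl))
  ... | inj₂ (inj₂ (refl , refl)) = trans (relabel-joined lab u w refl) (sym (relabel-source lab u w))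

  relabel-gathers : (_≡_ on lab) ⇒ Star R → (_≡_ on relabel lab u w) ⇒ Star R′
  relabel-gathers gather {a} {b} e with lab a ≟ lab w | lab b ≟ lab w
  ... | yes a~w | yes b~w = Star.map keep (gather (trans a~w (sym b~w)))
  ... | yes a~w | no _    = Star.map keep (gather a~w) ◅◅ link (inj₂ (refl , refl)) ◅ Star.map keep (gather e)
  ... | no _    | yes b~w = Star.map keep (gather e) ◅◅ link (inj₁ (refl , refl)) ◅ Star.map keep (gather (sym b~w))
  ... | no _    | no _    = Star.map keep (gather e)

module _ {V : Set} {R : Rel V 0ℓ} (sym-R : ∀ {a b} → R a b → R b a) where

  reach-from-either : ∀ {a b x y} → (∀ w → Star R a w ⊎ Star R b w) → ¬ Star R x y →
                      ∀ w → Star R x w ⊎ Star R y w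
  reach-from-either {a} {b} {x} {y} sides x↮y w with sides x | sides y | sides w
  ... | inj₁ a→x | inj₁ a→y | _        = ⊥-elim (x↮y (Star.reverse sym-R a→x ◅◅ a→y))
  ... | inj₂ b→x | inj₂ b→y | _        = ⊥-elim (x↮y (Star.reverse sym-R b→x ◅◅ b→y))
  ... | inj₁ a→x | inj₂ _   | inj₁ a→w = inj₁ (Star.reverse sym-R a→x ◅◅ a→w)
  ... | inj₁ _   | inj₂ b→y | inj₂ b→w = inj₂ (Star.reverse sym-R b→y ◅◅ b→w)
  ... | inj₂ b→x | inj₁ _   | inj₂ b→w = inj₁ (Star.reverse sym-R b→x ◅◅ b→w)
  ... | inj₂ _   | inj₁ a→y | inj₁ a→w = inj₂ (Star.reverse sym-R a→y ◅◅ a→w)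

nth : {A : Set} → A → List A → ℕ → A
nth d []       _       = d
nth d (x ∷ xs) zero    = x
nth d (x ∷ xs) (suc t) = nth d xs t

module _ {A : Set} (d : A) where

  nth-length : ∀ xs → nth d xs (length xs) ≡ d
  nth-length []       = refl
  nth-length (_ ∷ xs) = nth-length xs

  All-nth : ∀ {P : A → Set} {xs} → All P xs → ∀ {t} → t < length xs → P (nth d xs t)
  All-nth (px ∷ _)  {zero}  _         = px
  All-nth (_ ∷ pxs) {suc t} (s≤s t<n) = All-nth pxs t<n

  nth-injective : ∀ {xs} → Unique xs → ∀ {s t} → s < length xs → t < length xs →
                  nth d xs s ≡ nth d xs t → s ≡ t
  nth-injective {_ ∷ _}  _         {zero}  {zero}  _         _         _ = refl
  nth-injective {_ ∷ _}  (x∉ ∷ _)  {zero}  {suc t} _         (s≤s t<n) e = ⊥-elim (All-nth x∉ t<n e)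
  nth-injective {_ ∷ _}  (x∉ ∷ _)  {suc s} {zero}  (s≤s s<n) _         e = ⊥-elim (All-nth x∉ s<n (sym e))
  nth-injective {_ ∷ _}  (_ ∷ uxs) {suc s} {suc t} (s≤s s<n) (s≤s t<n) e = cong suc (nth-injective uxs s<n t<n e)

module _ {V : Set} {R : Rel V 0ℓ} where

  vertices : ∀ {a b} → Star R a b → List V
  vertices {a} ε       = a ∷ []
  vertices {a} (_ ◅ p) = a ∷ vertices p

  Simple : ∀ {a b} → Star R a b → Set
  Simple p = Unique (vertices p)

  vertices-nonempty : ∀ {a b} (p : Star R a b) → 1 ≤ length (vertices p)
  vertices-nonempty ε       = s≤s z≤n
  vertices-nonempty (_ ◅ _) = s≤s z≤n

  module _ (d : V) where

    nth-vertices-head : ∀ {a b} (p : Star R a b) → nth d (vertices p) 0 ≡ a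
    nth-vertices-head ε       = refl
    nth-vertices-head (_ ◅ _) = refl

    nth-vertices-step : ∀ {a b} (p : Star R a b) {t} → suc t < length (vertices p) →
                        R (nth d (vertices p) t) (nth d (vertices p) (suc t))
    nth-vertices-step ε       (s≤s ())
    nth-vertices-step (r ◅ p) {zero}  _           = subst (R _) (sym (nth-vertices-head p)) r
    nth-vertices-step (_ ◅ p) {suc t} (s≤s 2+t<n) = nth-vertices-step p 2+t<n

    nth-vertices-last : ∀ {a b} (p : Star R a b) {t} → suc t ≡ length (vertices p) → nth d (vertices p) t ≡ b
    nth-vertices-last ε           {zero}     _ = refl
    nth-vertices-last (_ ◅ ε)     {suc zero} _ = refl
    nth-vertices-last (_ ◅ r ◅ p) {suc t}    e = nth-vertices-last (r ◅ p) (suc-injective e)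

  module _ (_≟ᵥ_ : DecidableEquality V) where

    suffix-from : ∀ {a b c} (q : Star R b c) → a ∈ vertices q → Simple q → Σ (Star R a c) Simple
    suffix-from ε       (here refl)  simple       = ε , simple
    suffix-from (r ◅ q) (here refl)  simple       = r ◅ q , simple
    suffix-from (_ ◅ q) (there a∈q)  (_ ∷ simple) = suffix-from q a∈q simple

    simplify : ∀ {a b} → Star R a b → Σ (Star R a b) Simple
    simplify ε = ε , [] ∷ []
    simplify {a} (r ◅ p) with simplify p
    ... | q , simple with any? (a ≟ᵥ_) (vertices q)
    ...   | yes a∈q = suffix-from q a∈q simple
    ...   | no a∉q  = r ◅ q , ¬Any⇒All¬ (vertices q) a∉q ∷ simple

    -- Indexing the simple path from u to w with default u puts u at position len, closing the cycle.
    AddsLink-cyclic : ∀ {R′ u w} → AddsLink R R′ u w → Star R u w → u ≢ w → ¬ R u w → Cyclic R′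
    AddsLink-cyclic {R′} {u} {w} X p u≢w ¬r with simplify p
    ... | ε , _     = ⊥-elim (u≢w refl)
    ... | r ◅ ε , _ = ⊥-elim (¬r r)
    ... | q@(_ ◅ _ ◅ q′) , simple = cycleℕ⇒cyclic {R = R′} record
      { len = length xs ; 3≤len = s≤s (s≤s (vertices-nonempty q′)) ; at = nth u xs
      ; at-injective = nth-injective u simple ; at-step = step ; at-closed = nth-length u xs }
      where
      open AddsLink X
      xs = vertices q
      step : ∀ {t} → t < length xs → R′ (nth u xs t) (nth u xs (suc t))
      step {t} t<len with suc t <? length xs
      ... | yes 1+t<len = keep (nth-vertices-step u q 1+t<len)
      ... | no ¬1+t<len = subst₂ R′ (sym (nth-vertices-last u q last))
                                  (sym (trans (cong (nth u xs) last) (nth-length u xs)))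
                                  (link (inj₂ (refl , refl)))
        where
        last = ≤-antisym t<len (≮⇒≥ ¬1+t<len)

-- Partitions of the tracked vertices

-- The tracked vertices: the centre, x = v₁, the frontier (the rim vertex reached last) and y.
data Slot : Set where
  sc sx sf sy : Slot

Labels : Set
Labels = ℕ × ℕ × ℕ × ℕ

get : Labels → Slot → ℕ
get (c , x , f , y) sc = c
get (c , x , f , y) sx = x
get (c , x , f , y) sf = f
get (c , x , f , y) sy = y

fromSlots : (Slot → ℕ) → Labels
fromSlots F = F sc , F sx , F sf , F sy

get-fromSlots : ∀ F → get (fromSlots F) ≗ F
get-fromSlots F sc = refl
get-fromSlots F sx = refl
get-fromSlots F sf = refl
get-fromSlots F sy = refl

SameBlocks : (Slot → ℕ) → (Slot → ℕ) → Set
SameBlocks F G = ∀ p q → (F p ≡ F q) ⇔ (G p ≡ G q)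

SameBlocks-sym : ∀ {F G} → SameBlocks F G → SameBlocks G F
SameBlocks-sym F~G p q = ⇔.sym (F~G p q)

SameBlocks-trans : ∀ {F G H} → SameBlocks F G → SameBlocks G H → SameBlocks F H
SameBlocks-trans F~G G~H p q = ⇔.trans (F~G p q) (G~H p q)

SameBlocks-reflexive : ∀ {F G} → F ≗ G → SameBlocks F G
SameBlocks-reflexive F≗G p q = mk⇔ (λ e → trans (sym (F≗G p)) (trans e (F≗G q)))
                                   (λ e → trans (F≗G p) (trans e (sym (F≗G q))))

SameBlocks-≗ : ∀ {F F′ G G′} → F ≗ F′ → G ≗ G′ → SameBlocks F G → SameBlocks F′ G′
SameBlocks-≗ F≗F′ G≗G′ F~G =
  SameBlocks-trans (SameBlocks-reflexive (sym ∘ F≗F′)) (SameBlocks-trans F~G (SameBlocks-reflexive G≗G′))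

module _ {F G : Slot → ℕ} (F~G : SameBlocks F G) where

  private
    agree : ∀ p b → (F p ≡ F b × G p ≡ G b) ⊎ (F p ≢ F b × G p ≢ G b)
    agree p b with F p ≟ F b
    ... | yes e = inj₁ (e , Equivalence.to (F~G p b) e)
    ... | no ¬e = inj₂ (¬e , ¬e ∘ Equivalence.from (F~G p b))

  relabel-blocks : ∀ a b → SameBlocks (relabel F a b) (relabel G a b)
  relabel-blocks a b p q with agree p b | agree q b
  ... | inj₁ (Fp , Gp) | inj₁ (Fq , Gq)
    rewrite relabel-joined F a b Fp | relabel-joined F a b Fq | relabel-joined G a b Gp | relabel-joined G a b Gq
    = mk⇔ (λ _ → refl) (λ _ → refl)
  ... | inj₁ (Fp , Gp) | inj₂ (Fq , Gq)
    rewrite relabel-joined F a b Fp | relabel-other F a b Fq | relabel-joined G a b Gp | relabel-other G a b Gq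
    = F~G a q
  ... | inj₂ (Fp , Gp) | inj₁ (Fq , Gq)
    rewrite relabel-other F a b Fp | relabel-joined F a b Fq | relabel-other G a b Gp | relabel-joined G a b Gq
    = F~G p a
  ... | inj₂ (Fp , Gp) | inj₂ (Fq , Gq)
    rewrite relabel-other F a b Fp | relabel-other F a b Fq | relabel-other G a b Gp | relabel-other G a b Gq
    = F~G p q

SameBlocks-∘ : ∀ {F G} (r : Slot → Slot) → SameBlocks F G → SameBlocks (F ∘ r) (G ∘ r)
SameBlocks-∘ r F~G p q = F~G (r p) (r q)

firstWith : (Slot → ℕ) → ℕ → ℕ
firstWith F v with F sc ≟ v | F sx ≟ v | F sf ≟ v
... | yes _ | _     | _     = 0
... | no _  | yes _ | _     = 1
... | no _  | no _  | yes _ = 2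
... | no _  | no _  | no _  = 3

slotAt : ℕ → Slot
slotAt 0 = sc
slotAt 1 = sx
slotAt 2 = sf
slotAt _ = sy

firstWith-slot : ∀ (F : Slot → ℕ) (p : Slot) → F (slotAt (firstWith F (F p))) ≡ F p
firstWith-slot F p with F sc ≟ F p | F sx ≟ F p | F sf ≟ F p
firstWith-slot F p  | yes e | _     | _     = e
firstWith-slot F p  | no _  | yes e | _     = e
firstWith-slot F p  | no _  | no _  | yes e = e
firstWith-slot F sc | no ≢c | no _  | no _  = ⊥-elim (≢c refl)
firstWith-slot F sx | no _  | no ≢x | no _  = ⊥-elim (≢x refl)
firstWith-slot F sf | no _  | no _  | no ≢f = ⊥-elim (≢f refl)
firstWith-slot F sy | no _  | no _  | no _  = refl

-- Labelling each slot by the first slot of its block makes the reachable states closed terms,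
-- so that the transfer recurrences below hold by evaluation.
normalise : Labels → Labels
normalise l = fromSlots (λ p → firstWith (get l) (get l p))

normalise-blocks : ∀ l → SameBlocks (get l) (get (normalise l))
normalise-blocks l = SameBlocks-sym (SameBlocks-≗ (sym ∘ get-fromSlots canonical) (λ _ → refl) canonical-blocks)
  where
  canonical : Slot → ℕ
  canonical p = firstWith (get l) (get l p)
  canonical-blocks : SameBlocks canonical (get l)
  canonical-blocks p q =
    mk⇔ (λ e → trans (sym (firstWith-slot (get l) p)) (trans (cong (get l ∘ slotAt) e) (firstWith-slot (get l) q)))
        (cong (firstWith (get l)))

merge : Labels → Slot → Slot → Labels
merge l a b = normalise (fromSlots (relabel (get l) a b))

merge-blocks : ∀ {F} l → SameBlocks F (get l) → ∀ a b → SameBlocks (relabel F a b) (get (merge l a b))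
merge-blocks l F~l a b = SameBlocks-trans (relabel-blocks F~l a b)
  (SameBlocks-trans (SameBlocks-reflexive (sym ∘ get-fromSlots (relabel (get l) a b))) (normalise-blocks _))

withFrontier : (Slot → ℕ) → ℕ → Slot → ℕ
withFrontier F v sf = v
withFrontier F v p  = F p

setFrontier : Labels → ℕ → Labels
setFrontier (c , x , _ , y) v = normalise (c , x , v , y)

setFrontier-blocks : ∀ l v → SameBlocks (withFrontier (get l) v) (get (setFrontier l v))
setFrontier-blocks l@(c , x , f , y) v = SameBlocks-trans (SameBlocks-reflexive same) (normalise-blocks (c , x , v , y))
  where
  same : withFrontier (get l) v ≗ get (c , x , v , y)
  same sc = refl
  same sx = refl
  same sf = refl
  same sy = refl

data FrontierView : Slot → Set where
  frontier : FrontierView sf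
  other    : ∀ {p} → p ≢ sf → (∀ F v → withFrontier F v p ≡ F p) → FrontierView p

frontierView : ∀ p → FrontierView p
frontierView sc = other (λ ()) (λ _ _ → refl)
frontierView sx = other (λ ()) (λ _ _ → refl)
frontierView sf = frontier
frontierView sy = other (λ ()) (λ _ _ → refl)

module _ {F G : Slot → ℕ} (F~G : SameBlocks F G) where

  withFrontier-copy : ∀ b → b ≢ sf → SameBlocks (withFrontier F (F b)) (withFrontier G (G b))
  withFrontier-copy b b≢sf = SameBlocks-≗ (copy F) (copy G) (SameBlocks-∘ pointTo F~G)
    where
    pointTo : Slot → Slot
    pointTo sf = b
    pointTo p  = p
    copy : ∀ H → H ∘ pointTo ≗ withFrontier H (H b)
    copy H sc = refl
    copy H sx = refl
    copy H sf = refl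
    copy H sy = refl

  withFrontier-fresh : ∀ {v w} → (∀ q → q ≢ sf → v ≢ F q) → (∀ q → q ≢ sf → w ≢ G q) →
                       SameBlocks (withFrontier F v) (withFrontier G w)
  withFrontier-fresh {v} {w} v-fresh w-fresh p q with frontierView p | frontierView q
  ... | frontier     | frontier = mk⇔ (λ _ → refl) (λ _ → refl)
  ... | frontier     | other q≢ eq rewrite eq F v | eq G w =
    mk⇔ (⊥-elim ∘ v-fresh q q≢) (⊥-elim ∘ w-fresh q q≢)
  ... | other p≢ eq  | frontier rewrite eq F v | eq G w =
    mk⇔ (⊥-elim ∘ v-fresh p p≢ ∘ sym) (⊥-elim ∘ w-fresh p p≢ ∘ sym)
  ... | other _ eqp  | other _ eqq rewrite eqp F v | eqq F v | eqp G w | eqq G w = F~G p q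

-- The automaton

data State : Set where
  fail : State
  live : Labels → State

-- The rim vertex reached next: an untouched vertex, y, or (when the rim closes) x.
data Kind : Set where
  fresh toY toX : Kind

closing : ∀ m → Vec Kind (suc m)
closing zero    = toX ∷ []
closing (suc m) = fresh ∷ closing m

guard : Labels → State
guard l with get l sx ≟ get l sy
... | yes _ = fail
... | no _  = live l

join : Labels → Slot → Slot → State
join l a b with get l a ≟ get l b
... | yes _ = fail
... | no _  = guard (merge l a b)

newLabel : Kind → Labels → ℕ
newLabel fresh l = suc (get l sc + get l sx + get l sy)
newLabel toY   l = get l sy
newLabel toX   l = get l sx

-- The frontier leaves the tracked set; if it shares no block, its component can never grow again.
advance : Kind → Labels → State
advance k l with get l sf ≟ get l sc ⊎-dec get l sf ≟ get l sx ⊎-dec get l sf ≟ get l sy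
... | yes _ = live (setFrontier l (newLabel k l))
... | no _  = fail

spokeStep : State → Bool → State
spokeStep fail     _     = fail
spokeStep (live l) false = live l
spokeStep (live l) true  = join l sc sf

rimStep : Kind → State → Bool → State
rimStep _     fail     _     = fail
rimStep k     (live l) false = advance k l
rimStep fresh (live l) true  = live l
rimStep toY   (live l) true  = join l sf sy
rimStep toX   (live l) true  = join l sf sx

step : Kind → State → Bool × Bool → State
step k s (p , q) = rimStep k (spokeStep s p) q

Accepting : State → Set
Accepting fail     = ⊥
Accepting (live l) = get l sx ≢ get l sy × ∀ p → get l p ≡ get l sx ⊎ get l p ≡ get l sy

all-slots? : {P : Slot → Set} → (∀ p → Dec (P p)) → Dec (∀ p → P p)
all-slots? {P} P? =
  map′ slotwise (λ all → all sc , all sx , all sf , all sy) (P? sc ×-dec P? sx ×-dec P? sf ×-dec P? sy)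
  where
  slotwise : P sc × P sx × P sf × P sy → ∀ p → P p
  slotwise (c , _ , _ , _) sc = c
  slotwise (_ , x , _ , _) sx = x
  slotwise (_ , _ , f , _) sf = f
  slotwise (_ , _ , _ , y) sy = y

accepting? : ∀ s → Dec (Accepting s)
accepting? fail     = no λ ()
accepting? (live l) =
  ¬? (get l sx ≟ get l sy) ×-dec all-slots? λ p → get l p ≟ get l sx ⊎-dec get l p ≟ get l sy

data JoinView (l : Labels) (a b : Slot) : State → Set where
  closes-cycle : get l a ≡ get l b → JoinView l a b fail
  links-x-y    : get l a ≢ get l b → get (merge l a b) sx ≡ get (merge l a b) sy → JoinView l a b fail
  merges       : get l a ≢ get l b → get (merge l a b) sx ≢ get (merge l a b) sy →
                 JoinView l a b (live (merge l a b))

joinView : ∀ l a b → JoinView l a b (join l a b)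
joinView l a b with get l a ≟ get l b
... | yes a~b = closes-cycle a~b
... | no a≁b with get (merge l a b) sx ≟ get (merge l a b) sy
...   | yes x~y = links-x-y a≁b x~y
...   | no x≁y  = merges a≁b x≁y

data AdvanceView (k : Kind) (l : Labels) : State → Set where
  shared   : ∀ q → q ≢ sf → get l sf ≡ get l q → AdvanceView k l (live (setFrontier l (newLabel k l)))
  unshared : (∀ q → q ≢ sf → get l sf ≢ get l q) → AdvanceView k l fail

advanceView : ∀ k l → AdvanceView k l (advance k l)
advanceView k l with get l sf ≟ get l sc ⊎-dec get l sf ≟ get l sx ⊎-dec get l sf ≟ get l sy
... | yes (inj₁ f~c)        = shared sc (λ ()) f~c
... | yes (inj₂ (inj₁ f~x)) = shared sx (λ ()) f~x
... | yes (inj₂ (inj₂ f~y)) = shared sy (λ ()) f~y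
... | no unshared′          = unshared lonely
  where
  lonely : ∀ q → q ≢ sf → get l sf ≢ get l q
  lonely sc _    f~c = unshared′ (inj₁ f~c)
  lonely sx _    f~x = unshared′ (inj₂ (inj₁ f~x))
  lonely sf q≢sf _   = q≢sf refl
  lonely sy _    f~y = unshared′ (inj₂ (inj₂ f~y))

-- Enumerating accepted edge sets

module _ {B X Y : Set} (tag : B → X → Y) (f : B → List X) where

  tagged : List B → List Y
  tagged []       = []
  tagged (b ∷ bs) = map (tag b) (f b) ++ tagged bs

  length-tagged : ∀ bs → length (tagged bs) ≡ sum (map (length ∘ f) bs)
  length-tagged []       = refl
  length-tagged (b ∷ bs) = trans (length-++ (map (tag b) (f b)))
                                 (cong₂ _+_ (length-map (tag b) (f b)) (length-tagged bs))

  ∈-tagged⁺ : ∀ {b x bs} → b ∈ bs → x ∈ f b → tag b x ∈ tagged bs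
  ∈-tagged⁺ {bs = b ∷ bs} (here refl) x∈ = ∈-++⁺ˡ (∈-map⁺ (tag b) x∈)
  ∈-tagged⁺ {bs = b ∷ bs} (there b∈) x∈  = ∈-++⁺ʳ (map (tag b) (f b)) (∈-tagged⁺ b∈ x∈)

  ∈-tagged⁻ : ∀ {y} bs → y ∈ tagged bs → ∃ λ b → b ∈ bs × Σ X λ x → x ∈ f b × y ≡ tag b x
  ∈-tagged⁻ (b ∷ bs) y∈ with ∈-++⁻ (map (tag b) (f b)) y∈
  ... | inj₁ y∈b with ∈-map⁻ (tag b) y∈b
  ...   | x , x∈ , refl = b , here refl , x , x∈ , refl
  ∈-tagged⁻ (b ∷ bs) y∈ | inj₂ y∈bs with ∈-tagged⁻ bs y∈bs
  ...   | b′ , b′∈ , x , x∈ , eq = b′ , there b′∈ , x , x∈ , eq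

  tagged-unique : (∀ {b b′ x x′} → tag b x ≡ tag b′ x′ → b ≡ b′ × x ≡ x′) →
                  ∀ {bs} → Unique bs → (∀ b → Unique (f b)) → Unique (tagged bs)
  tagged-unique tag-injective {[]}     _           _ = []
  tagged-unique tag-injective {b ∷ bs} (b∉ ∷ ubs) uf =
    Unique.++⁺ (Unique.map⁺ (proj₂ ∘ tag-injective) (uf b)) (tagged-unique tag-injective ubs uf) disjoint
    where
    disjoint : ∀ {y} → ¬ (y ∈ map (tag b) (f b) × y ∈ tagged bs)
    disjoint (y∈b , y∈bs) with ∈-map⁻ (tag b) y∈b | ∈-tagged⁻ bs y∈bs
    ... | _ , _ , refl | b′ , b′∈ , _ , _ , eq =
      All¬⇒¬Any b∉ (subst (_∈ bs) (sym (proj₁ (tag-injective eq))) b′∈)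

Bits : ℕ → Set
Bits t = Vec Bool t × Vec Bool t

consBits : ∀ {t} → Bool × Bool → Bits t → Bits (suc t)
consBits (p , q) (c , d) = p ∷ c , q ∷ d

consBits-injective : ∀ {t b b′} {x x′ : Bits t} → consBits b x ≡ consBits b′ x′ → b ≡ b′ × x ≡ x′
consBits-injective {b = _ , _} {_ , _} {_ , _} {_ , _} refl = refl , refl

bitPairs : List (Bool × Bool)
bitPairs = (false , false) ∷ (false , true) ∷ (true , false) ∷ (true , true) ∷ []

∈-bitPairs : ∀ b → b ∈ bitPairs
∈-bitPairs (false , false) = here refl
∈-bitPairs (false , true)  = there (here refl)
∈-bitPairs (true , false)  = there (there (here refl))
∈-bitPairs (true , true)   = there (there (there (here refl)))

bitPairs-unique : Unique bitPairs
bitPairs-unique =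
  ((λ ()) ∷ (λ ()) ∷ (λ ()) ∷ []) ∷ ((λ ()) ∷ (λ ()) ∷ []) ∷ ((λ ()) ∷ []) ∷ [] ∷ []

run : ∀ {t} → Vec Kind t → State → Bits t → State
run []       s _                 = s
run (k ∷ ks) s (p ∷ c , q ∷ d) = run ks (step k s (p , q)) (c , d)

run-fail : ∀ {t} (ks : Vec Kind t) bs → run ks fail bs ≡ fail
run-fail []       _                 = refl
run-fail (_ ∷ ks) (_ ∷ c , _ ∷ d) = run-fail ks (c , d)

count : ∀ {t} → Vec Kind t → State → ℕ
count _        fail     = 0
count []       (live l) with accepting? (live l)
... | yes _ = 1
... | no _  = 0
count (k ∷ ks) (live l) = sum (map (count ks ∘ step k (live l)) bitPairs)

completions : ∀ {t} → Vec Kind t → State → List (Bits t)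
completions _        fail     = []
completions []       (live l) with accepting? (live l)
... | yes _ = [ [] , [] ]
... | no _  = []
completions (k ∷ ks) (live l) = tagged consBits (completions ks ∘ step k (live l)) bitPairs

length-completions : ∀ {t} (ks : Vec Kind t) s → length (completions ks s) ≡ count ks s
length-completions _        fail     = refl
length-completions []       (live l) with accepting? (live l)
... | yes _ = refl
... | no _  = refl
length-completions (k ∷ ks) (live l) =
  trans (length-tagged consBits (completions ks ∘ step k (live l)) bitPairs)
        (cong sum (map-cong (length-completions ks ∘ step k (live l)) bitPairs))

completions-unique : ∀ {t} (ks : Vec Kind t) s → Unique (completions ks s)
completions-unique _        fail     = []
completions-unique []       (live l) with accepting? (live l)
... | yes _ = [] ∷ []
... | no _  = []
completions-unique (k ∷ ks) (live l) =
  tagged-unique consBits _ consBits-injective bitPairs-unique (completions-unique ks ∘ step k (live l))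

∈-completions : ∀ {t} (ks : Vec Kind t) s bs → bs ∈ completions ks s ⇔ Accepting (run ks s bs)
∈-completions ks fail bs rewrite run-fail ks bs = mk⇔ (λ ()) (λ ())
∈-completions [] (live l) ([] , []) with accepting? (live l)
... | yes acc = mk⇔ (λ _ → acc) (λ _ → here refl)
... | no ¬acc = mk⇔ (λ ()) (⊥-elim ∘ ¬acc)
∈-completions (k ∷ ks) (live l) (p ∷ c , q ∷ d) = mk⇔ to from
  where
  branch = completions ks ∘ step k (live l)
  to : (p ∷ c , q ∷ d) ∈ completions (k ∷ ks) (live l) → Accepting (run (k ∷ ks) (live l) (p ∷ c , q ∷ d))
  to bs∈ with ∈-tagged⁻ consBits branch bitPairs bs∈
  ... | b , _ , x , x∈ , eq with consBits-injective eq
  ...   | refl , refl = Equivalence.to (∈-completions ks (step k (live l) (p , q)) (c , d)) x∈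
  from : Accepting (run (k ∷ ks) (live l) (p ∷ c , q ∷ d)) → (p ∷ c , q ∷ d) ∈ completions (k ∷ ks) (live l)
  from acc = ∈-tagged⁺ consBits branch (∈-bitPairs (p , q))
               (Equivalence.from (∈-completions ks (step k (live l) (p , q)) (c , d)) acc)

-- The wheel

module Wheel {n : ℕ} {{_ : NonZero n}} (3≤n : 3 ≤ n) where

  V = Vertex n

  cycV : ℕ → V
  cycV i = cyc (i mod n)

  x : V
  x = cycV 0

  0<n : 0 < n
  0<n = ≤-trans (s≤s z≤n) 3≤n

  cycV-injective : ∀ {i j} → i < n → j < n → cycV i ≡ cycV j → i ≡ j
  cycV-injective i<n j<n e = trans (sym (toℕ-mod i<n)) (trans (cong toℕ (cyc-injective e)) (toℕ-mod j<n))

  cycV-n : cycV n ≡ x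
  cycV-n = cong cyc (toℕ-injective (trans (toℕ-mod-self n) (sym (toℕ-mod 0<n))))

  toℕ-mod-inverse : ∀ (j : Fin n) → toℕ j mod n ≡ j
  toℕ-mod-inverse j = toℕ-injective (toℕ-mod (toℕ<n j))

  cycV-toℕ : ∀ (j : Fin n) → cycV (toℕ j) ≡ cyc j
  cycV-toℕ j = cong cyc (toℕ-mod-inverse j)

  centre≢cycV : ∀ {i} → centre ≢ cycV i
  centre≢cycV ()

  cycV-≢ : ∀ {i k} → i < k → k < n → cycV i ≢ cycV k
  cycV-≢ i<k k<n e = <-irrefl (cycV-injective (<-trans i<k k<n) k<n e) i<k

  cycV-closing : ∀ {i} → suc i ≡ n → cycV (suc i) ≡ x
  cycV-closing 1+i≡n = trans (cong cycV 1+i≡n) cycV-n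

  spoke : ℕ → Edge n
  spoke i = (i mod n) ↑ˡ n

  rimEdge : ℕ → Edge n
  rimEdge i = n ↑ʳ (i mod n)

  data EdgeView : Edge n → Set where
    spokeAt : ∀ k → EdgeView (k ↑ˡ n)
    rimAt   : ∀ k → EdgeView (n ↑ʳ k)

  edgeView : ∀ e → EdgeView e
  edgeView e with splitAt n e in eq
  ... | inj₁ k = subst EdgeView (splitAt⁻¹-↑ˡ eq) (spokeAt k)
  ... | inj₂ k = subst EdgeView (splitAt⁻¹-↑ʳ eq) (rimAt k)

  ends-spokeAt : ∀ k → ends (k ↑ˡ n) ≡ (centre , cyc k)
  ends-spokeAt k rewrite splitAt-↑ˡ n k n = refl

  ends-rimAt : ∀ k → ends (n ↑ʳ k) ≡ (cyc k , cyc (next k))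
  ends-rimAt k rewrite splitAt-↑ʳ n n k = refl

  ends-spoke : ∀ i → ends (spoke i) ≡ (centre , cycV i)
  ends-spoke i = ends-spokeAt (i mod n)

  ends-rim : ∀ {i} → i < n → ends (rimEdge i) ≡ (cycV i , cycV (suc i))
  ends-rim {i} i<n = trans (ends-rimAt (i mod n)) (cong (λ k → cycV i , cyc (suc k mod n)) (toℕ-mod i<n))

  Joins⇔Link : ∀ {e : Edge n} {u w : V} → ends e ≡ (u , w) → ∀ {a b} → Joins e a b ⇔ Link u w a b
  Joins⇔Link {e} eq {a} {b} = mk⇔ (λ j → subst (λ p → Link (proj₁ p) (proj₂ p) a b) eq (toLink e j))
                                  (λ l → fromLink e (subst (λ p → Link (proj₁ p) (proj₂ p) a b) (sym eq) l))
    where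
    toLink : ∀ (e : Edge n) → Joins e a b → Link (proj₁ (ends e)) (proj₂ (ends e)) a b
    toLink e j with ends e
    ... | _ , _ = j
    fromLink : ∀ (e : Edge n) → Link (proj₁ (ends e)) (proj₂ (ends e)) a b → Joins e a b
    fromLink e l with ends e
    ... | _ , _ = l

  Below : ℕ → ℕ → Edge n → Set
  Below s r e = [ (λ k → toℕ k < s) , (λ k → toℕ k < r) ]′ (splitAt n e)

  Below-spokeAt : ∀ {s r} k → Below s r (k ↑ˡ n) ≡ (toℕ k < s)
  Below-spokeAt k rewrite splitAt-↑ˡ n k n = refl

  Below-rimAt : ∀ {s r} k → Below s r (n ↑ʳ k) ≡ (toℕ k < r)
  Below-rimAt k rewrite splitAt-↑ʳ n n k = refl

  Below-mono : ∀ {s r s′ r′} → s ≤ s′ → r ≤ r′ → ∀ {e} → Below s r e → Below s′ r′ e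
  Below-mono s≤s′ r≤r′ {e} below with splitAt n e
  ... | inj₁ k = <-≤-trans below s≤s′
  ... | inj₂ k = <-≤-trans below r≤r′

  Below-all : ∀ e → Below n n e
  Below-all e with splitAt n e
  ... | inj₁ k = toℕ<n k
  ... | inj₂ k = toℕ<n k

  Below-spoke : ∀ {i r} → i < n → Below (suc i) r (spoke i)
  Below-spoke {i} i<n = subst (λ B → B) (sym (Below-spokeAt (i mod n))) (≤-reflexive (cong suc (toℕ-mod i<n)))

  Below-rim : ∀ {i s} → i < n → Below s (suc i) (rimEdge i)
  Below-rim {i} i<n = subst (λ B → B) (sym (Below-rimAt (i mod n))) (≤-reflexive (cong suc (toℕ-mod i<n)))

  private
    last-or-below : ∀ {i} → i < n → ∀ (k : Fin n) → toℕ k < suc i → toℕ k < i ⊎ k ≡ i mod n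
    last-or-below i<n k k<1+i with m<1+n⇒m<n∨m≡n k<1+i
    ... | inj₁ k<i = inj₁ k<i
    ... | inj₂ k≡i = inj₂ (toℕ-injective (trans k≡i (sym (toℕ-mod i<n))))

  Below-new-spoke : ∀ {i r} → i < n → ∀ {e} → Below (suc i) r e → Below i r e ⊎ e ≡ spoke i
  Below-new-spoke {i} {r} i<n {e} below with edgeView e
  ... | spokeAt k rewrite Below-spokeAt {suc i} {r} k | Below-spokeAt {i} {r} k with last-or-below i<n k below
  ...   | inj₁ k<i  = inj₁ k<i
  ...   | inj₂ refl = inj₂ refl
  Below-new-spoke {i} {r} i<n {e} below | rimAt k rewrite Below-rimAt {suc i} {r} k | Below-rimAt {i} {r} k = inj₁ below

  Below-new-rim : ∀ {i s} → i < n → ∀ {e} → Below s (suc i) e → Below s i e ⊎ e ≡ rimEdge i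
  Below-new-rim {i} {s} i<n {e} below with edgeView e
  ... | rimAt k rewrite Below-rimAt {s} {suc i} k | Below-rimAt {s} {i} k with last-or-below i<n k below
  ...   | inj₁ k<i  = inj₁ k<i
  ...   | inj₂ refl = inj₂ refl
  Below-new-rim {i} {s} i<n {e} below | spokeAt k
    rewrite Below-spokeAt {s} {suc i} k | Below-spokeAt {s} {i} k = inj₁ below

  EdgeStep : Bool → Rel V 0ℓ → Rel V 0ℓ → V → V → Set
  EdgeStep true  R R′ u w = AddsLink R R′ u w
  EdgeStep false R R′ u w = R ⇒ R′ × R′ ⇒ R

  module Edges (S : Subset (n + n)) where

    Prefix : ℕ → ℕ → Rel V 0ℓ
    Prefix s r a b = Σ (Edge n) λ e → e ∈ₛ S × Below s r e × Joins e a b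

    Prefix-step : ∀ {s r s′ r′ u w} e₀ → ends e₀ ≡ (u , w) →
                  (∀ {e} → Below s r e → Below s′ r′ e) → (∀ {e} → Below s′ r′ e → Below s r e ⊎ e ≡ e₀) →
                  Below s′ r′ e₀ → EdgeStep (lookup S e₀) (Prefix s r) (Prefix s′ r′) u w
    Prefix-step {s} {r} {s′} {r′} e₀ ends₀ grow new below₀ with lookup S e₀ in bit
    ... | true  = record { keep = keep ; link = link ; split = split }
      where
      keep : Prefix s r ⇒ Prefix s′ r′
      keep (e , e∈S , below , joins) = e , e∈S , grow below , joins
      link : Link _ _ ⇒ Prefix s′ r′
      link l = e₀ , lookup⇒[]= e₀ S bit , below₀ , Equivalence.from (Joins⇔Link ends₀) l
      split : Prefix s′ r′ ⇒ (Prefix s r ∪ Link _ _)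
      split (e , e∈S , below , joins) with new below
      ... | inj₁ below′ = inj₁ (e , e∈S , below′ , joins)
      ... | inj₂ refl   = inj₂ (Equivalence.to (Joins⇔Link ends₀) joins)
    ... | false = keep , shrink
      where
      keep : Prefix s r ⇒ Prefix s′ r′
      keep (e , e∈S , below , joins) = e , e∈S , grow below , joins
      shrink : Prefix s′ r′ ⇒ Prefix s r
      shrink (e , e∈S , below , joins) with new below
      ... | inj₁ below′ = e , e∈S , below′ , joins
      ... | inj₂ refl   with trans (sym bit) ([]=⇒lookup e∈S)
      ...   | ()

    spoke-step : ∀ {i} → i < n → EdgeStep (lookup S (spoke i)) (Prefix i i) (Prefix (suc i) i) centre (cycV i)
    spoke-step i<n =
      Prefix-step (spoke _) (ends-spoke _) (Below-mono (n≤1+n _) ≤-refl) (Below-new-spoke i<n) (Below-spoke i<n)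

    rim-step : ∀ {i} → i < n →
               EdgeStep (lookup S (rimEdge i)) (Prefix (suc i) i) (Prefix (suc i) (suc i)) (cycV i) (cycV (suc i))
    rim-step i<n =
      Prefix-step (rimEdge _) (ends-rim i<n) (Below-mono ≤-refl (n≤1+n _)) (Below-new-rim i<n) (Below-rim i<n)

    no-spoke-yet : ∀ {i} → i < n → ¬ Prefix i i centre (cycV i)
    no-spoke-yet {i} i<n (e , _ , below , joins) with edgeView e
    ... | spokeAt k with Equivalence.to (Joins⇔Link (ends-spokeAt k)) joins
    ...   | inj₁ (_ , k≡i) = <-irrefl (trans (cong toℕ (cyc-injective k≡i)) (toℕ-mod i<n))
                                      (subst (λ B → B) (Below-spokeAt k) below)
    ...   | inj₂ (() , _)
    no-spoke-yet i<n (e , _ , below , joins) | rimAt k with Equivalence.to (Joins⇔Link (ends-rimAt k)) joins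
    ...   | inj₁ (() , _)
    ...   | inj₂ (_ , ())

    no-closing-rim : ∀ {i} → suc i ≡ n → ¬ Prefix (suc i) i (cycV i) x
    no-closing-rim {i} 1+i≡n (e , _ , below , joins) with edgeView e
    ... | spokeAt k with Equivalence.to (Joins⇔Link (ends-spokeAt k)) joins
    ...   | inj₁ (() , _)
    ...   | inj₂ (() , _)
    no-closing-rim {i} 1+i≡n (e , _ , below , joins) | rimAt k with Equivalence.to (Joins⇔Link (ends-rimAt k)) joins
    ...   | inj₁ (k≡i , _) = <-irrefl (cycV-injective (toℕ<n k) i<n (trans (cycV-toℕ k) k≡i))
                                      (subst (λ B → B) (Below-rimAt k) below)
      where i<n = subst (i <_) 1+i≡n (n<1+n i)
    ...   | inj₂ (k≡x , next≡i) = <-irrefl (sym n≡2) 3≤n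
      where
      i<n = subst (i <_) 1+i≡n (n<1+n i)
      k≡0 : toℕ k ≡ 0
      k≡0 = cycV-injective (toℕ<n k) 0<n (trans (cycV-toℕ k) k≡x)
      next≡1 : toℕ (next k) ≡ 1
      next≡1 = trans (cong (λ t → toℕ (suc t mod n)) k≡0) (toℕ-mod (≤-trans (s≤s (s≤s z≤n)) 3≤n))
      n≡2 : n ≡ 2
      n≡2 = trans (sym 1+i≡n)
                  (cong suc (trans (sym (cycV-injective (toℕ<n (next k)) i<n (trans (cycV-toℕ (next k)) next≡i)))
                                   next≡1))

    Prefix⇔Adjacent : Prefix n n ⇒ Adjacent S × Adjacent S ⇒ Prefix n n
    Prefix⇔Adjacent = (λ (e , e∈S , _ , joins) → e , e∈S , joins)
                    , (λ (e , e∈S , joins) → e , e∈S , Below-all e , joins)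

    Adjacent-sym : ∀ {a b} → Adjacent S a b → Adjacent S b a
    Adjacent-sym (e , e∈S , joins) = e , e∈S , Joins-sym e joins
      where
      Joins-sym : ∀ e {a b} → Joins e a b → Joins e b a
      Joins-sym e j with ends e
      ... | _ , _ = swap j

-- Simulation invariant

module Tracking {n : ℕ} {{_ : NonZero n}} (3≤n : 3 ≤ n) (y : Vertex n) where
  open Wheel 3≤n

  tracked : ℕ → Slot → V
  tracked i sc = centre
  tracked i sx = x
  tracked i sf = cycV i
  tracked i sy = y

  tracked-other : ∀ {i p} → p ≢ sf → tracked (suc i) p ≡ tracked i p
  tracked-other {p = sc} _    = refl
  tracked-other {p = sx} _    = refl
  tracked-other {p = sf} p≢sf = ⊥-elim (p≢sf refl)
  tracked-other {p = sy} _    = refl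

  Live : ℕ → V → Set
  Live i z = (∃ λ p → z ≡ tracked i p) ⊎ (∃ λ k → i < k × k < n × z ≡ cycV k)

  NotLive : ℕ → (V → ℕ) → V → Set
  NotLive i lab w = ∀ {z} → Live i z → lab w ≢ lab z

  Isolated : (V → ℕ) → V → Set
  Isolated lab t = ∀ {z} → lab z ≡ lab t → z ≡ t

  Avoids : ℕ → V → Set
  Avoids j u = ∀ {k} → j < k → k < n → u ≢ cycV k

  nothing-beyond : ∀ {i u} → suc i ≡ n → Avoids (suc i) u
  nothing-beyond 1+i≡n 1+i<k k<n = ⊥-elim (<-asym 1+i<k (subst (_ <_) (sym 1+i≡n) k<n))

  -- cycV i is the frontier; the rim vertices after position j are still isolated (j differs
  -- from i only in the middle of a rim step).
  record Invariant (R : Rel V 0ℓ) (i j : ℕ) (l : Labels) : Set where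
    field
      lab       : V → ℕ
      respects  : R =[ lab ]⇒ _≡_
      gathers   : (_≡_ on lab) ⇒ Star R
      acyclic   : ¬ Cyclic R
      blocks    : SameBlocks (lab ∘ tracked i) (get l)
      untouched : ∀ {k} → j < k → k < n → Isolated lab (cycV k)
      covered   : ∀ {k} → k < i → ∃ λ p → lab (cycV k) ≡ lab (tracked i p)

  Failed : Rel V 0ℓ → ℕ → Set
  Failed R i = Cyclic R ⊎ Star R x y ⊎ ∃ λ lab → R =[ lab ]⇒ _≡_ × ∃ (NotLive i lab)

  Inv : Rel V 0ℓ → ℕ → ℕ → State → Set
  Inv R i j fail     = Failed R i
  Inv R i j (live l) = Invariant R i j l

  Inv-same : ∀ {R R′ i j} → R ⇒ R′ × R′ ⇒ R → ∀ s → Inv R i j s → Inv R′ i j s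
  Inv-same {R} {R′} (to , _) fail (inj₁ cycle)               = inj₁ (Cyclic-map {R = R} {R′} to cycle)
  Inv-same (to , _)    fail (inj₂ (inj₁ x→y))                = inj₂ (inj₁ (Star.map to x→y))
  Inv-same (_ , from)  fail (inj₂ (inj₂ (lab , resp , dead))) = inj₂ (inj₂ (lab , resp ∘ from , dead))
  Inv-same {R} {R′} (to , from) (live l) I = record
    { lab = lab ; respects = respects ∘ from ; gathers = Star.map to ∘ gathers
    ; acyclic = acyclic ∘ Cyclic-map {R = R′} {R} from
    ; blocks = blocks ; untouched = untouched ; covered = covered }
    where open Invariant I

  Live-tracked : ∀ {i} p → Live i (tracked i p)
  Live-tracked p = inj₁ (p , refl)

  Live-next : ∀ {i} → suc i ≤ n → Live i (cycV (suc i))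
  Live-next {i} 1+i≤n with m≤n⇒m<n∨m≡n 1+i≤n
  ... | inj₁ 1+i<n  = inj₂ (suc i , n<1+n i , 1+i<n , refl)
  ... | inj₂ 1+i≡n = inj₁ (sx , trans (cong cycV 1+i≡n) cycV-n)

  Live-advance : ∀ {i z} → suc i ≤ n → Live (suc i) z → Live i z
  Live-advance 1+i≤n (inj₁ (sf , refl))  = Live-next 1+i≤n
  Live-advance 1+i≤n (inj₁ (sc , refl))  = Live-tracked sc
  Live-advance 1+i≤n (inj₁ (sx , refl))  = Live-tracked sx
  Live-advance 1+i≤n (inj₁ (sy , refl))  = Live-tracked sy
  Live-advance {i} 1+i≤n (inj₂ (k , 1+i<k , k<n , refl)) = inj₂ (k , <-trans (n<1+n i) 1+i<k , k<n , refl)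

  Failed-link : ∀ {R R′ u w i} → AddsLink R R′ u w → Live i u → Live i w → Failed R i → Failed R′ i
  Failed-link {R} {R′} X _ _ (inj₁ cycle) = inj₁ (Cyclic-map {R = R} {R′} (AddsLink.keep X) cycle)
  Failed-link X _    _    (inj₂ (inj₁ x→y))                     = inj₂ (inj₁ (Star.map (AddsLink.keep X) x→y))
  Failed-link {u = u} {w} X live-u live-w (inj₂ (inj₂ (lab , resp , w₀ , dead))) =
    inj₂ (inj₂ (relabel lab u w , relabel-respects X resp , w₀ ,
                λ live-z → relabel-≢ lab u w (dead live-u) (dead live-w) (dead live-z)))

  Failed-advance : ∀ {R i} → suc i ≤ n → Failed R i → Failed R (suc i)
  Failed-advance _     (inj₁ cycle)                          = inj₁ cycle
  Failed-advance _     (inj₂ (inj₁ x→y))                     = inj₂ (inj₁ x→y)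
  Failed-advance 1+i≤n (inj₂ (inj₂ (lab , resp , w₀ , dead))) =
    inj₂ (inj₂ (lab , resp , w₀ , dead ∘ Live-advance 1+i≤n))

  Invariant-link : ∀ {R R′ i j j′ l l′ u w} (I : Invariant R i j l) → AddsLink R R′ u w →
                   Invariant.lab I u ≢ Invariant.lab I w → Live i u → Live i w → j ≤ j′ →
                   Avoids j′ u → Avoids j′ w →
                   SameBlocks (relabel (Invariant.lab I) u w ∘ tracked i) (get l′) → Invariant R′ i j′ l′
  Invariant-link {u = u} {w} I X u≁w _ _ j≤j′ u-avoids w-avoids blocks′ = record
    { lab       = relabel lab u w
    ; respects  = relabel-respects X respects
    ; gathers   = relabel-gathers X gathers
    ; acyclic   = AddsLink-acyclic X respects u≁w acyclic
    ; blocks    = blocks′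
    ; untouched = λ j′<k k<n → relabel-isolated lab u w (untouched (≤-<-trans j≤j′ j′<k) k<n)
                                                 (u-avoids j′<k k<n) (w-avoids j′<k k<n)
    ; covered   = λ k<i → let p , e = covered k<i in p , cong (replace (lab w) (lab u)) e
    }
    where open Invariant I

  Invariant-advance : ∀ {R i l} (I : Invariant R i (suc i) l) → suc i ≤ n →
                      Invariant.lab I (cycV (suc i)) ≡ Invariant.lab I (cycV i) → Invariant R (suc i) (suc i) l
  Invariant-advance {i = i} I 1+i≤n joined = record
    { lab = lab ; respects = respects ; gathers = gathers ; acyclic = acyclic
    ; blocks = SameBlocks-≗ same (λ _ → refl) blocks ; untouched = untouched ; covered = covered′ }
    where
    open Invariant I
    same : lab ∘ tracked i ≗ lab ∘ tracked (suc i)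
    same sc = refl
    same sx = refl
    same sf = sym joined
    same sy = refl
    covered′ : ∀ {k} → k < suc i → ∃ λ p → lab (cycV k) ≡ lab (tracked (suc i) p)
    covered′ k<1+i with m<1+n⇒m<n∨m≡n k<1+i
    ... | inj₁ k<i  = let p , e = covered k<i in p , trans e (same p)
    ... | inj₂ refl = sf , sym joined

  Fits : ℕ → Kind → Set
  Fits i fresh = suc i < n × y ≢ cycV (suc i)
  Fits i toY   = suc i < n × y ≡ cycV (suc i)
  Fits i toX   = suc i ≡ n

  Fits-≤ : ∀ {i} k → Fits i k → suc i ≤ n
  Fits-≤ fresh (1+i<n , _) = <⇒≤ 1+i<n
  Fits-≤ toY   (1+i<n , _) = <⇒≤ 1+i<n
  Fits-≤ toX   1+i≡n      = ≤-reflexive 1+i≡n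

  fresh-untracked : ∀ {i} → Fits i fresh → ∀ p → tracked i p ≢ cycV (suc i)
  fresh-untracked _               sc = centre≢cycV
  fresh-untracked (1+i<n , _)     sx = λ e → 1+n≢0 (sym (cycV-injective 0<n 1+i<n e))
  fresh-untracked (1+i<n , _)     sf = cycV-≢ (n<1+n _) 1+i<n
  fresh-untracked (_ , y≢)        sy = y≢

  Invariant-merge : ∀ {R R′ i j j′ l} a b (I : Invariant R i j l) → AddsLink R R′ (tracked i a) (tracked i b) →
                    get l a ≢ get l b → j ≤ j′ → Avoids j′ (tracked i a) → Avoids j′ (tracked i b) →
                    Invariant R′ i j′ (merge l a b)
  Invariant-merge {l = l} a b I X a≁b j≤j′ a-avoids b-avoids =
    Invariant-link I X (a≁b ∘ Equivalence.to (blocks a b)) (Live-tracked a) (Live-tracked b) j≤j′ a-avoids b-avoids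
                   (merge-blocks l blocks a b)
    where open Invariant I

  Inv-join : ∀ {R R′ i j j′ l} a b (I : Invariant R i j l) → AddsLink R R′ (tracked i a) (tracked i b) →
             tracked i a ≢ tracked i b → ¬ R (tracked i a) (tracked i b) → j ≤ j′ →
             Avoids j′ (tracked i a) → Avoids j′ (tracked i b) → Inv R′ i j′ (join l a b)
  Inv-join {l = l} a b I X a≢b ¬r j≤j′ a-avoids b-avoids with join l a b | joinView l a b
  ... | _ | closes-cycle a~b  =
    inj₁ (AddsLink-cyclic Fin._≟_ X (Invariant.gathers I (Equivalence.from (Invariant.blocks I a b) a~b)) a≢b ¬r)
  ... | _ | links-x-y a≁b x~y =
    inj₂ (inj₁ (Invariant.gathers I′ (Equivalence.from (Invariant.blocks I′ sx sy) x~y)))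
    where I′ = Invariant-merge a b I X a≁b j≤j′ a-avoids b-avoids
  ... | _ | merges a≁b _      = Invariant-merge a b I X a≁b j≤j′ a-avoids b-avoids

  join-live-blocks : ∀ {l a b s} → JoinView l a b s → ∀ {l′} → s ≡ live l′ → get l′ a ≡ get l′ b
  join-live-blocks {l} {a} {b} (merges _ _) refl =
    Equivalence.to (merge-blocks l (SameBlocks-reflexive (λ _ → refl)) a b a b)
                   (trans (relabel-source (get l) a b) (sym (relabel-joined (get l) a b {b} refl)))

  Inv-advance : ∀ {R i} b → tracked i b ≡ cycV (suc i) → suc i ≤ n → ∀ s →
                (∀ {l′} → s ≡ live l′ → get l′ sf ≡ get l′ b) → Inv R i (suc i) s → Inv R (suc i) (suc i) s
  Inv-advance b _     1+i≤n fail     _      F = Failed-advance 1+i≤n F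
  Inv-advance b next≡ 1+i≤n (live l) joined I =
    Invariant-advance I 1+i≤n (trans (cong lab (sym next≡)) (sym (Equivalence.from (blocks sf b) (joined refl))))
    where open Invariant I

  fresh-join : ∀ {R R′ i l} → Fits i fresh → Invariant R i i l → AddsLink R R′ (cycV i) (cycV (suc i)) →
               Invariant R′ (suc i) (suc i) l
  fresh-join {i = i} {l} fits@(1+i<n , _) I X =
    Invariant-advance I′ (<⇒≤ 1+i<n) (trans (relabel-joined lab (cycV i) (cycV (suc i)) {cycV (suc i)} refl)
                                             (sym (relabel-source lab (cycV i) (cycV (suc i)))))
    where
    open Invariant I
    isolated = untouched (n<1+n i) 1+i<n
    unchanged : lab ∘ tracked i ≗ relabel lab (cycV i) (cycV (suc i)) ∘ tracked i
    unchanged p = sym (relabel-other lab (cycV i) (cycV (suc i)) (fresh-untracked fits p ∘ isolated))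
    I′ = Invariant-link I X (cycV-≢ (n<1+n i) 1+i<n ∘ isolated) (Live-tracked sf) (Live-next (<⇒≤ 1+i<n)) (n≤1+n i)
           (λ 1+i<k → cycV-≢ (<-trans (n<1+n i) 1+i<k)) cycV-≢
           (SameBlocks-≗ unchanged (λ _ → refl) blocks)

  next-untouched-or-x : ∀ {R i l} k → Fits i k → (I : Invariant R i i l) →
               (Isolated (Invariant.lab I) (cycV (suc i)) × suc i < n) ⊎ (cycV (suc i) ≡ x)
  next-untouched-or-x {i = i} fresh (1+i<n , _) I = inj₁ (Invariant.untouched I (n<1+n i) 1+i<n , 1+i<n)
  next-untouched-or-x {i = i} toY   (1+i<n , _) I = inj₁ (Invariant.untouched I (n<1+n i) 1+i<n , 1+i<n)
  next-untouched-or-x         toX   1+i≡n      I = inj₂ (cycV-closing 1+i≡n)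

  new-frontier-blocks : ∀ {R i l} k → Fits i k → (I : Invariant R i i l) →
                        SameBlocks (Invariant.lab I ∘ tracked (suc i)) (get (setFrontier l (newLabel k l)))
  new-frontier-blocks {i = i} {l} k fits I =
    SameBlocks-≗ frontier-moved (λ _ → refl)
                 (SameBlocks-trans (copy-or-fresh k fits) (setFrontier-blocks l (newLabel k l)))
    where
    open Invariant I
    F = lab ∘ tracked i
    frontier-moved : withFrontier F (lab (cycV (suc i))) ≗ lab ∘ tracked (suc i)
    frontier-moved sc = refl
    frontier-moved sx = refl
    frontier-moved sf = refl
    frontier-moved sy = refl
    fresh-label : ∀ q → q ≢ sf → newLabel fresh l ≢ get l q
    fresh-label q q≢sf e = <-irrefl (sym e) (s≤s (below q q≢sf))
      where
      c = get l sc
      below : ∀ q → q ≢ sf → get l q ≤ c + get l sx + get l sy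
      below sc _    = ≤-trans (m≤m+n c (get l sx)) (m≤m+n _ (get l sy))
      below sx _    = ≤-trans (m≤n+m (get l sx) c) (m≤m+n _ (get l sy))
      below sf q≢sf = ⊥-elim (q≢sf refl)
      below sy _    = m≤n+m (get l sy) _
    copy-or-fresh : ∀ k → Fits i k →
                    SameBlocks (withFrontier F (lab (cycV (suc i)))) (withFrontier (get l) (newLabel k l))
    copy-or-fresh fresh fits@(1+i<n , _) =
      withFrontier-fresh blocks (λ q _ e → fresh-untracked fits q (untouched (n<1+n i) 1+i<n (sym e))) fresh-label
    copy-or-fresh toY (_ , y≡) =
      subst (λ v → SameBlocks (withFrontier F v) _) (cong lab y≡) (withFrontier-copy blocks sy (λ ()))
    copy-or-fresh toX 1+i≡n = subst (λ v → SameBlocks (withFrontier F v) _) (cong lab (sym (cycV-closing 1+i≡n)))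
                                    (withFrontier-copy blocks sx (λ ()))

  new-frontier : ∀ {R i l} k → Fits i k → Invariant R i i l → Inv R (suc i) (suc i) (advance k l)
  new-frontier {R} {i} {l} k fits I with advance k l | advanceView k l
  ... | _ | shared q q≢sf f~q = record
    { lab = lab ; respects = respects ; gathers = gathers ; acyclic = acyclic
    ; blocks = new-frontier-blocks k fits I
    ; untouched = λ 1+i<k → untouched (<-trans (n<1+n i) 1+i<k)
    ; covered = covered′ }
    where
    open Invariant I
    redirect : ∀ {k} p → lab (cycV k) ≡ lab (tracked i p) →
               ∃ λ p′ → lab (cycV k) ≡ lab (tracked (suc i) p′)
    redirect p e with frontierView p
    ... | frontier     = q , trans e (trans (Equivalence.from (blocks sf q) f~q) (cong lab (sym (tracked-other q≢sf))))
    ... | other p≢sf _ = p , trans e (cong lab (sym (tracked-other p≢sf)))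
    covered′ : ∀ {k} → k < suc i → ∃ λ p → lab (cycV k) ≡ lab (tracked (suc i) p)
    covered′ k<1+i with m<1+n⇒m<n∨m≡n k<1+i
    ... | inj₁ k<i  = let p , e = covered k<i in redirect p e
    ... | inj₂ refl = redirect sf refl
  ... | _ | unshared lonely = inj₂ (inj₂ (lab , respects , cycV i , dead))
    where
    open Invariant I
    dead : NotLive (suc i) lab (cycV i)
    dead (inj₁ (p , refl)) with frontierView p
    ... | other p≢sf _ =
      λ e → lonely p p≢sf (Equivalence.to (blocks sf p) (trans e (cong lab (tracked-other p≢sf))))
    ... | frontier with next-untouched-or-x k fits I
    ...   | inj₁ (isolated , 1+i<n) = cycV-≢ (n<1+n i) 1+i<n ∘ isolated
    ...   | inj₂ next≡x           =
      λ e → lonely sx (λ ()) (Equivalence.to (blocks sf sx) (trans e (cong lab next≡x)))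
    dead (inj₂ (k , 1+i<k , k<n , refl)) =
      cycV-≢ (<-trans (n<1+n i) 1+i<k) k<n ∘ untouched (<-trans (n<1+n i) 1+i<k) k<n

  spoke-lemma : ∀ {R R′ i} b s → EdgeStep b R R′ centre (cycV i) → ¬ R centre (cycV i) →
                Inv R i i s → Inv R′ i i (spokeStep s b)
  spoke-lemma {i = i} false fail same _ F = Inv-same {j = i} same fail F
  spoke-lemma false (live l) same _  I = Inv-same same (live l) I
  spoke-lemma true  fail     X    _  F = Failed-link X (Live-tracked sc) (Live-tracked sf) F
  spoke-lemma true  (live l) X    ¬r I =
    Inv-join sc sf I X centre≢cycV ¬r ≤-refl (λ _ _ → centre≢cycV) cycV-≢

  rim-lemma : ∀ {R R′ i} k b s → Fits i k → EdgeStep b R R′ (cycV i) (cycV (suc i)) →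
              (suc i ≡ n → ¬ R (cycV i) x) → Inv R i i s → Inv R′ (suc i) (suc i) (rimStep k s b)
  rim-lemma {i = i} k false fail fits same _ F = Failed-advance (Fits-≤ k fits) (Inv-same {j = i} same fail F)
  rim-lemma k     true  fail     fits X    _ F =
    Failed-advance (Fits-≤ k fits) (Failed-link X (Live-tracked sf) (Live-next (Fits-≤ k fits)) F)
  rim-lemma k     false (live l) fits same _ I = new-frontier k fits (Inv-same same (live l) I)
  rim-lemma fresh true  (live l) fits X    _ I = fresh-join fits I X
  rim-lemma {R} {R′} {i} toY true (live l) (1+i<n , y≡) X _ I =
    Inv-advance sy y≡ (<⇒≤ 1+i<n) (join l sf sy) (join-live-blocks (joinView l sf sy))
      (Inv-join sf sy I (subst (AddsLink R R′ (cycV i)) (sym y≡) X) (λ e → cycV-≢ (n<1+n i) 1+i<n (trans e y≡))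
                ¬r (n≤1+n i) (λ 1+i<k → cycV-≢ (<-trans (n<1+n i) 1+i<k))
                (λ 1+i<k k<n → cycV-≢ 1+i<k k<n ∘ trans (sym y≡)))
    where
    ¬r : ¬ R (cycV i) y
    ¬r r = cycV-≢ (n<1+n i) 1+i<n
             (Invariant.untouched I (n<1+n i) 1+i<n (trans (Invariant.respects I r) (cong (Invariant.lab I) y≡)))
  rim-lemma {R} {R′} {i} toX true (live l) 1+i≡n X no-rim I =
    Inv-advance sx (sym (cycV-closing 1+i≡n)) (≤-reflexive 1+i≡n) (join l sf sx) (join-live-blocks (joinView l sf sx))
      (Inv-join sf sx I (subst (AddsLink R R′ (cycV i)) (cycV-closing 1+i≡n) X) i≢0 (no-rim 1+i≡n) (n≤1+n i)
                (nothing-beyond 1+i≡n) (nothing-beyond 1+i≡n))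
    where
    i≢0 : cycV i ≢ x
    i≢0 e = <-irrefl (trans (cong suc (sym (cycV-injective (subst (i <_) 1+i≡n (n<1+n i)) 0<n e))) 1+i≡n)
                     (<-trans (n<1+n 1) 3≤n)

  ScheduleFits : ∀ {t} → ℕ → Vec Kind t → Set
  ScheduleFits i []       = ⊤
  ScheduleFits i (k ∷ ks) = Fits i k × ScheduleFits (suc i) ks

  closing-fits : ∀ {i} m → i + suc m ≡ n → (∀ {j} → i ≤ j → suc j < n → y ≢ cycV (suc j)) →
                 ScheduleFits i (closing m)
  closing-fits {i} zero    i+1≡n _      = trans (+-comm 1 i) i+1≡n , tt
  closing-fits {i} (suc m) i+t≡n behind =
    (1+i<n , behind ≤-refl 1+i<n) ,
    closing-fits m (trans (sym (+-suc i (suc m))) i+t≡n) (behind ∘ ≤-trans (n≤1+n i))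
    where
    1+i<n : suc i < n
    1+i<n = subst (suc i <_) i+t≡n (subst (suc i <_) (sym (trans (+-suc i (suc m)) (cong suc (+-suc i m))))
                                             (s≤s (s≤s (m≤m+n i m))))

  rim-behind : ∀ {a} → y ≡ cycV a → a < n → ∀ {j} → a ≤ j → suc j < n → y ≢ cycV (suc j)
  rim-behind y≡ a<n a≤j 1+j<n e = <-irrefl (cycV-injective a<n 1+j<n (trans (sym y≡) e)) (s≤s a≤j)

  start : State
  start = live (normalise (fromSlots (toℕ ∘ tracked 0)))

  module Simulation (S : Subset (n + n)) where
    open Edges S

    simulate : ∀ {t} i (ks : Vec Kind t) s (c d : Vec Bool t) → i + t ≡ n → ScheduleFits i ks →
               (∀ j → lookup c j ≡ lookup S (spoke (i + toℕ j))) →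
               (∀ j → lookup d j ≡ lookup S (rimEdge (i + toℕ j))) →
               Inv (Prefix i i) i i s → Inv (Prefix n n) n n (run ks s (c , d))
    simulate i [] s [] [] i+0≡n _ _ _ I = subst (λ m → Inv (Prefix m m) m m s) (trans (sym (+-identityʳ i)) i+0≡n) I
    simulate {suc t} i (k ∷ ks) s (p ∷ c) (q ∷ d) i+t≡n (fits , fits′) spokes rims I =
      simulate (suc i) ks (step k s (p , q)) c d (trans (sym (+-suc i t)) i+t≡n) fits′
               (λ j → trans (spokes (Fin.suc j)) (cong (lookup S ∘ spoke) (+-suc i (toℕ j))))
               (λ j → trans (rims (Fin.suc j)) (cong (lookup S ∘ rimEdge) (+-suc i (toℕ j))))
               (rim-lemma k q (spokeStep s p) fits (subst (λ b → EdgeStep b _ _ _ _) (sym q≡) (rim-step i<n))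
                          no-closing-rim
                 (spoke-lemma p s (subst (λ b → EdgeStep b _ _ _ _) (sym p≡) (spoke-step i<n))
                              (no-spoke-yet i<n) I))
      where
      i<n : i < n
      i<n = subst (i <_) i+t≡n (m<m+n i (s≤s z≤n))
      p≡ : p ≡ lookup S (spoke i)
      p≡ = trans (spokes Fin.zero) (cong (lookup S ∘ spoke) (+-identityʳ i))
      q≡ : q ≡ lookup S (rimEdge i)
      q≡ = trans (rims Fin.zero) (cong (lookup S ∘ rimEdge) (+-identityʳ i))

    initial : Inv (Prefix 0 0) 0 0 start
    initial = record
      { lab = toℕ ; respects = λ r → ⊥-elim (nothing-below r)
      ; gathers = λ e → subst (Star _ _) (toℕ-injective e) ε
      ; acyclic = λ (_ , _ , _ , _ , step) → nothing-below (step Fin.zero)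
      ; blocks = SameBlocks-≗ (get-fromSlots (toℕ ∘ tracked 0)) (λ _ → refl)
                              (normalise-blocks (fromSlots (toℕ ∘ tracked 0)))
      ; untouched = λ _ _ → toℕ-injective ; covered = λ () }
      where
      nothing-below : ∀ {a b} → ¬ Prefix 0 0 a b
      nothing-below (e , _ , below , _) with splitAt n e
      ... | inj₁ _ = n≮0 below
      ... | inj₂ _ = n≮0 below

    failed-not-separating : Failed (Adjacent S) n → ¬ SepForest x y S
    failed-not-separating (inj₁ cycle)     (acyclic , _ , _)   = acyclic cycle
    failed-not-separating (inj₂ (inj₁ x→y)) (_ , _ , separated) = separated x→y
    failed-not-separating (inj₂ (inj₂ (lab , resp , w₀ , dead))) (_ , (a , b , _ , sides) , separated)
      with reach-from-either Adjacent-sym sides separated w₀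
    ... | inj₁ x→w₀ = dead (Live-tracked sx) (sym (Star-constant resp x→w₀))
    ... | inj₂ y→w₀ = dead (Live-tracked sy) (sym (Star-constant resp y→w₀))

    module _ {l} (I : Invariant (Adjacent S) n n l) where
      open Invariant I

      separating⇒accepting : SepForest x y S → Accepting (live l)
      separating⇒accepting (_ , (a , b , _ , sides) , separated) =
        (λ x~y → separated (gathers (Equivalence.from (blocks sx sy) x~y))) , side
        where
        side : ∀ p → get l p ≡ get l sx ⊎ get l p ≡ get l sy
        side p with reach-from-either Adjacent-sym sides separated (tracked n p)
        ... | inj₁ x→p = inj₁ (Equivalence.to (blocks p sx) (sym (Star-constant respects x→p)))
        ... | inj₂ y→p = inj₂ (Equivalence.to (blocks p sy) (sym (Star-constant respects y→p)))

      accepting⇒separating : Accepting (live l) → SepForest x y S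
      accepting⇒separating (x≁y , side) = acyclic , (x , y , separated , reach) , separated
        where
        separated : ¬ Connected S x y
        separated x→y = x≁y (Equivalence.to (blocks sx sy) (Star-constant respects x→y))
        reach-slot : ∀ p → Connected S x (tracked n p) ⊎ Connected S y (tracked n p)
        reach-slot p with side p
        ... | inj₁ p~x = inj₁ (gathers (sym (Equivalence.from (blocks p sx) p~x)))
        ... | inj₂ p~y = inj₂ (gathers (sym (Equivalence.from (blocks p sy) p~y)))
        reach : ∀ w → Connected S x w ⊎ Connected S y w
        reach Fin.zero    = reach-slot sc
        reach (Fin.suc j) with covered (toℕ<n j)
        ... | p , e with reach-slot p
        ...   | inj₁ x→p = inj₁ (subst (Connected S x) (cycV-toℕ j) (x→p ◅◅ gathers (sym e)))
        ...   | inj₂ y→p = inj₂ (subst (Connected S y) (cycV-toℕ j) (y→p ◅◅ gathers (sym e)))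

    decide : ∀ s → Inv (Prefix n n) n n s → Accepting s ⇔ SepForest x y S
    decide fail     F = mk⇔ (λ ()) (⊥-elim ∘ failed-not-separating (Inv-same {j = n} Prefix⇔Adjacent fail F))
    decide (live l) I = mk⇔ (accepting⇒separating I′) (separating⇒accepting I′)
      where I′ = Inv-same Prefix⇔Adjacent (live l) I

  forest-count : ∀ (ks : Vec Kind n) → ScheduleFits 0 ks → ForestCount x y (count ks start)
  forest-count ks fits =
    map toSubset (completions ks start) , Unique.map⁺ toSubset-injective (completions-unique ks start) ,
    (λ S → mk⇔ (to S) (from S)) , trans (length-map toSubset (completions ks start)) (length-completions ks start)
    where
    toSubset : Bits n → Subset (n + n)
    toSubset (c , d) = c ++ᵥ d
    toSubset-injective : ∀ {b b′} → toSubset b ≡ toSubset b′ → b ≡ b′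
    toSubset-injective {c , d} {c′ , d′} eq with ++-injective c c′ eq
    ... | refl , refl = refl
    accepting⇔separating : ∀ c d → Accepting (run ks start (c , d)) ⇔ SepForest x y (c ++ᵥ d)
    accepting⇔separating c d = decide (run ks start (c , d))
      (simulate 0 ks start c d refl fits
        (λ j → trans (sym (lookup-++ˡ c d j)) (cong (λ k → lookup (c ++ᵥ d) (k ↑ˡ n)) (sym (toℕ-mod-inverse j))))
        (λ j → trans (sym (lookup-++ʳ c d j)) (cong (λ k → lookup (c ++ᵥ d) (n ↑ʳ k)) (sym (toℕ-mod-inverse j))))
        initial)
      where open Simulation (c ++ᵥ d)
    to : ∀ S → S ∈ map toSubset (completions ks start) → SepForest x y S
    to S S∈ with ∈-map⁻ toSubset S∈
    ... | (c , d) , cd∈ , refl =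
      Equivalence.to (accepting⇔separating c d) (Equivalence.to (∈-completions ks start (c , d)) cd∈)
    from : ∀ S → SepForest x y S → S ∈ map toSubset (completions ks start)
    from S sep with Vec.splitAt n S
    ... | c , d , refl =
      ∈-map⁺ toSubset (Equivalence.from (∈-completions ks start (c , d)) (Equivalence.from (accepting⇔separating c d) sep))

-- Transfer recurrences

-- A state is named by its blocks: in cx∣f∣y the centre and x are joined, the frontier and y alone.
cxf∣y cx∣fy cx∣f∣y cfy∣x cf∣x∣y cy∣xf cy∣x∣f c∣x∣fy c∣x∣f∣y : Labels
cxf∣y   = 0 , 0 , 0 , 3
cx∣fy   = 0 , 0 , 2 , 2
cx∣f∣y  = 0 , 0 , 2 , 3
cfy∣x   = 0 , 1 , 0 , 0
cf∣x∣y  = 0 , 1 , 0 , 3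
cy∣xf   = 0 , 1 , 1 , 0
cy∣x∣f  = 0 , 1 , 2 , 0
c∣x∣fy  = 0 , 1 , 2 , 2
c∣x∣f∣y = 0 , 1 , 2 , 3

N : ℕ → Labels → ℕ
N u l = count (closing u) (live l)

record Transfer (u φ ψ : ℕ) : Set where
  field
    #cxf∣y   : N u cxf∣y ≡ ψ
    #cx∣fy   : N u cx∣fy ≡ ψ
    #cx∣f∣y  : N u cx∣f∣y ≡ ψ + φ
    #cfy∣x   : N u cfy∣x ≡ ψ
    #cf∣x∣y  : N u cf∣x∣y ≡ φ
    #cy∣xf   : N u cy∣xf ≡ ψ
    #cy∣x∣f  : N u cy∣x∣f ≡ ψ + φ
    #c∣x∣fy  : N u c∣x∣fy + 2 ≡ φ + (ψ + φ)
    #c∣x∣f∣y : N u c∣x∣f∣y ≡ ψ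
open Transfer

via-offset : ∀ {lhs rhs i Φ} c P → i + 2 ≡ Φ → lhs ≡ c * (i + 2) + P → c * Φ + P ≡ rhs → lhs ≡ rhs
via-offset c P i+2 l r = trans l (trans (cong (λ t → c * t + P) i+2) r)

transfer-step : ∀ {u φ ψ} → Transfer u φ ψ → Transfer (suc u) (ψ + φ) ((ψ + φ) + ψ)
transfer-step {u} {φ} {ψ} T = record
  { #cxf∣y = cxf∣y′ ; #cx∣fy = cx∣fy′ ; #cx∣f∣y = cx∣f∣y′ ; #cfy∣x = cfy∣x′ ; #cf∣x∣y = cf∣x∣y′
  ; #cy∣xf = cy∣xf′ ; #cy∣x∣f = cy∣x∣f′ ; #c∣x∣fy = c∣x∣fy′ ; #c∣x∣f∣y = c∣x∣f∣y′ }
  where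
  vars = φ List.∷ ψ List.∷ List.[]
  cxf∣y′ : N (suc u) cxf∣y ≡ (ψ + φ) + ψ
  cxf∣y′ rewrite #cx∣f∣y T | #cxf∣y T = solve vars
  cx∣fy′ : N (suc u) cx∣fy ≡ (ψ + φ) + ψ
  cx∣fy′ rewrite #cx∣f∣y T | #cx∣fy T = solve vars
  cx∣f∣y′ : N (suc u) cx∣f∣y ≡ ((ψ + φ) + ψ) + (ψ + φ)
  cx∣f∣y′ rewrite #cx∣f∣y T | #cxf∣y T = solve vars
  cfy∣x′ : N (suc u) cfy∣x ≡ (ψ + φ) + ψ
  cfy∣x′ rewrite #cy∣x∣f T | #cfy∣x T = solve vars
  cf∣x∣y′ : N (suc u) cf∣x∣y ≡ ψ + φ
  cf∣x∣y′ rewrite #c∣x∣f∣y T | #cf∣x∣y T = solve vars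
  cy∣xf′ : N (suc u) cy∣xf ≡ (ψ + φ) + ψ
  cy∣xf′ rewrite #cy∣x∣f T | #cy∣xf T = solve vars
  cy∣x∣f′ : N (suc u) cy∣x∣f ≡ ((ψ + φ) + ψ) + (ψ + φ)
  cy∣x∣f′ rewrite #cy∣x∣f T | #cfy∣x T = solve vars
  c∣x∣f∣y′ : N (suc u) c∣x∣f∣y ≡ (ψ + φ) + ψ
  c∣x∣f∣y′ rewrite #c∣x∣f∣y T | #cf∣x∣y T = solve vars
  c∣x∣fy′ : N (suc u) c∣x∣fy + 2 ≡ (ψ + φ) + (((ψ + φ) + ψ) + (ψ + φ))
  c∣x∣fy′ rewrite #c∣x∣f∣y T | #cy∣x∣f T | #cfy∣x T with N u c∣x∣fy | #c∣x∣fy T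
  ... | i | i+2 = via-offset 1 ((ψ + (ψ + φ)) + ψ) i+2 (solve (i List.∷ vars)) (solve vars)

transfer : ∀ u → Transfer u (fib (1 + 2 * u)) (fib (2 + 2 * u))
transfer zero    = record
  { #cxf∣y = refl ; #cx∣fy = refl ; #cx∣f∣y = refl ; #cfy∣x = refl ; #cf∣x∣y = refl
  ; #cy∣xf = refl ; #cy∣x∣f = refl ; #c∣x∣fy = refl ; #c∣x∣f∣y = refl }
transfer (suc u) =
  subst₂ (Transfer (suc u)) (cong (λ k → fib (1 + k)) double) (cong (λ k → fib (2 + k)) double) (transfer-step (transfer u))
  where
  double : 2 + 2 * u ≡ 2 * suc u
  double = sym (*-suc 2 u)

module _ {m φ ψ} (T : Transfer m φ ψ) where

  private
    vars = φ List.∷ ψ List.∷ List.[]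

  count-v₂+2 : count (toY ∷ fresh ∷ closing m) (live (0 , 1 , 1 , 3)) + 2 ≡ 2 * (((ψ + φ) + ψ) + (ψ + φ))
  count-v₂+2 rewrite #c∣x∣f∣y T | #cy∣x∣f T | #cfy∣x T | #cx∣f∣y T | #cx∣fy T
    with N m c∣x∣fy | #c∣x∣fy T
  ... | i | i+2 = via-offset 1 (2 * φ + 5 * ψ) i+2 (solve (i List.∷ vars)) (solve vars)

  count-v₃+6 : count (fresh ∷ toY ∷ closing m) (live (0 , 1 , 1 , 3)) + 6 ≡
               2 * ((ψ + φ) + (((ψ + φ) + ψ) + (ψ + φ)))
  count-v₃+6 rewrite #cfy∣x T | #cx∣fy T with N m c∣x∣fy | #c∣x∣fy T
  ... | i | i+2 = via-offset 3 (5 * ψ) i+2 (solve (i List.∷ vars)) (solve vars)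

  count-centre′ : count (fresh ∷ fresh ∷ closing m) (live (0 , 1 , 1 , 0)) ≡
                  (((ψ + φ) + ψ) + (ψ + φ)) + ((ψ + φ) + ψ)
  count-centre′ rewrite #cy∣x∣f T | #cfy∣x T | #cy∣xf T = solve vars

m+2k≡2n⇒m≡2[n∸k] : ∀ m n k → m + 2 * k ≡ 2 * n → m ≡ 2 * (n ∸ k)
m+2k≡2n⇒m≡2[n∸k] m n k e = trans (sym (m+n∸n≡m m (2 * k))) (trans (cong (_∸ 2 * k) e) (sym (*-distribˡ-∸ 2 n k)))

lucas-fib : ∀ k → lucas (suc k) ≡ fib k + fib (suc (suc k))
lucas-fib zero          = refl
lucas-fib (suc zero)    = refl
lucas-fib (suc (suc k)) = trans (cong₂ _+_ (lucas-fib (suc k)) (lucas-fib k)) (regroup (fib k) (fib (suc k)))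
  where
  regroup : ∀ a b → (b + ((b + a) + b)) + (a + (b + a)) ≡ (b + a) + (((b + a) + b) + (b + a))
  regroup a b = solve (a List.∷ b List.∷ List.[])

2*[3+m]≡6+2*m : ∀ m → 2 * (3 + m) ≡ 6 + 2 * m
2*[3+m]≡6+2*m = solve-∀

count-v₂ : ∀ m → count (toY ∷ fresh ∷ closing m) (live (0 , 1 , 1 , 3)) ≡ 2 * (fib (2 * (3 + m) ∸ 1) ∸ 1)
count-v₂ m = m+2k≡2n⇒m≡2[n∸k] _ (fib (2 * (3 + m) ∸ 1)) 1
  (trans (count-v₂+2 (transfer m)) (cong (λ k → 2 * fib (k ∸ 1)) (sym (2*[3+m]≡6+2*m m))))

count-v₃ : ∀ m → count (fresh ∷ toY ∷ closing m) (live (0 , 1 , 1 , 3)) ≡ 2 * (lucas (2 * (3 + m) ∸ 2) ∸ 3)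
count-v₃ m = m+2k≡2n⇒m≡2[n∸k] _ (lucas (2 * (3 + m) ∸ 2)) 3
  (trans (count-v₃+6 (transfer m))
         (cong (2 *_) (trans (sym (lucas-fib (3 + 2 * m))) (cong (λ k → lucas (k ∸ 2)) (sym (2*[3+m]≡6+2*m m))))))

count-centre : ∀ m → count (fresh ∷ fresh ∷ closing m) (live (0 , 1 , 1 , 0)) ≡ fib (2 * (3 + m))
count-centre m = trans (count-centre′ (transfer m)) (cong fib (sym (2*[3+m]≡6+2*m m)))

3≤3+m : ∀ m → 3 ≤ 3 + m
3≤3+m m = s≤s (s≤s (s≤s z≤n))

module _ (m : ℕ) where

  private
    1<n : 1 < 3 + m
    1<n = s≤s (s≤s z≤n)
    2<n : 2 < 3 + m
    2<n = s≤s (s≤s (s≤s z≤n))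

  fits-v₂ : Tracking.ScheduleFits (3≤3+m m) (cyc (suc zero)) 0 (toY ∷ fresh ∷ closing m)
  fits-v₂ = (1<n , refl) , (2<n , λ ()) ,
            closing-fits m refl (λ 2≤j → rim-behind refl 1<n (≤-trans (s≤s z≤n) 2≤j))
    where open Tracking (3≤3+m m) (cyc (suc zero))

  fits-v₃ : Tracking.ScheduleFits (3≤3+m m) (cyc (suc (suc zero))) 0 (fresh ∷ toY ∷ closing m)
  fits-v₃ = (1<n , λ ()) , (2<n , refl) , closing-fits m refl (rim-behind refl 2<n)
    where open Tracking (3≤3+m m) (cyc (suc (suc zero)))

  fits-centre : Tracking.ScheduleFits (3≤3+m m) centre 0 (fresh ∷ fresh ∷ closing m)
  fits-centre = (1<n , λ ()) , (2<n , λ ()) , closing-fits m refl (λ _ _ ())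
    where open Tracking (3≤3+m m) centre

proposition1 : (m : ℕ) → let n = 3 + m in
    ForestCount {n} (cyc zero) (cyc (suc zero)) (2 * (fib (2 * n ∸ 1) ∸ 1))
    × ForestCount {n} (cyc zero) (cyc (suc (suc zero))) (2 * (lucas (2 * n ∸ 2) ∸ 3))
    × ForestCount {n} (cyc zero) centre (fib (2 * n))
proposition1 m =
  -- With n = 3 + m, start evaluates to the initial states above and x = cycV 0 to cyc zero.
  subst (ForestCount _ _) (count-v₂ m) (forest-count _ (toY ∷ fresh ∷ closing m) (fits-v₂ m)) ,
  subst (ForestCount _ _) (count-v₃ m) (forest-count _ (fresh ∷ toY ∷ closing m) (fits-v₃ m)) ,
  subst (ForestCount _ _) (count-centre m) (forest-count _ (fresh ∷ fresh ∷ closing m) (fits-centre m))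
  where open Tracking (3≤3+m m) using (forest-count)
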